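{- Let $\alpha\in[0,1/10]$ and $\beta\in(0,1)$. Let $S\subseteq\mathcal{S}_d$ be a set of $n$ rankings, and let $A$ be the set of active symbols (defined below). If $|A|\le\beta\cdot\mathrm{OPT}/n$, then on input $S,\alpha$ the Relative Order Algorithm outputs a fair ranking $\bar{\sigma}$ with $\sum_{\pi\in S}\mathcal{U}(\pi,\bar{\sigma})\le(1+3\beta(1+8\alpha))\,\mathrm{OPT}$.
   Context: Candidates $[d]$ are partitioned into groups $G_1,\dots,G_g$ with fairness parameters $(\lambda_i),(\mu_i)\in[0,1]^g$, $k\in[d]$; a ranking is fair if every prefix $P$ with $|P|\ge k$ satisfies $\lfloor\lambda_i|P|\rfloor\le|P\cap G_i|\le\lceil\mu_i|P|\rceil$ for all $i$ (a fair ranking is assumed to exist). Ulam distance $\mathcal{U}(\pi_1,\pi_2)=d-|\mathrm{LCS}(\pi_1,\pi_2)|$. Let $\sigma^*$ be an arbitrary fair median: a fair ranking minimizing $\sum_{\pi\in S}\mathcal{U}(\pi,\sigma^*)$, and $\mathrm{OPT}$ this minimum. For each $\pi\in S$ fix an arbitrary LCS $\ell_\pi$ of $\pi$ and $\sigma^*$. For $a\in[d]$, $\mathrm{cost}(a)=|\{\pi\in S: a\notin\ell_\pi\}|$; $a$ is lazy if $\mathrm{cost}(a)\le\alpha n$ and active otherwise; $A$ is the set of active symbols. Relative Order Algorithm on $(S,\alpha)$: form the directed graph $H$ on vertex set $[d]$ with an edge $(a,b)$ whenever $a$ precedes $b$ in at least $(1-2\alpha)n$ rankings of $S$; for each vertex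 $v\in[d]$ in turn, if $v$ is still present and lies on a cycle, find a shortest cycle containing $v$ and delete all its vertices from $H$; let $\bar{H}$ be the resulting acyclic graph and $\bar{\sigma}_{par}$ a sequence giving a topological ordering of $V(\bar{H})$; output a fair ranking $\bar{\sigma}\in\mathcal{S}_d$ maximizing the length of a longest common subsequence with $\bar{\sigma}_{par}$. -}

module Defs where

open import Data.Bool using (Bool; true; false; _∧_; not; if_then_else_)
open import Data.Nat as ℕ using (ℕ; zero; suc; _∸_; _⊔_)
open import Data.Fin as Fin using (Fin; _≟_; inject₁; fromℕ)
open import Data.Integer as ℤ using (ℤ; +_)
open import Data.Rational as ℚ using (ℚ; floor; ceiling; _/_; 1ℚ)
open import Data.List using (List; []; _∷_; _++_; length; filter; map; foldr; take; allFin)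
open import Data.Nat.ListAction using (sum)
open import Data.List.Relation.Unary.Unique.Propositional using (Unique)
open import Data.List.Relation.Binary.Permutation.Propositional using (_↭_)
open import Data.List.Relation.Binary.Sublist.Propositional using (_⊆_)
open import Data.List.Membership.Propositional using (_∈_)
open import Data.Product using (_×_; Σ; ∃; _,_)
open import Data.Sum using (_⊎_)
open import Relation.Nullary using (¬_; ¬?; Dec; yes; no; does)
open import Data.Empty using (⊥)
import Data.Bool as Bool
open import Relation.Binary.PropositionalEquality using (_≡_)
open import Function using (_⇔_)

ℕ→ℚ : ℕ → ℚ
ℕ→ℚ m = + m / 1

Σ[_]_ : (n : ℕ) → (Fin n → ℕ) → ℕ
Σ[ n ] f = sum (map f (allFin n))

countFin : (n : ℕ) {P : Fin n → Set} → ((i : Fin n) → Dec (P i)) → ℕ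
countFin n P? = length (filter P? (allFin n))

module _ {d : ℕ} where

  private
    _≟d_ = _≟_ {n = d}

  open import Data.List.Membership.DecPropositional _≟d_ using (_∈?_)
  open import Data.List.Relation.Binary.Sublist.DecPropositional _≟d_ using (_⊆?_)

  -- A ranking of [d]: a permutation of the d candidates, listed from top to bottom.
  IsRanking : List (Fin d) → Set
  IsRanking π = π ↭ allFin d

  subseqs : List (Fin d) → List (List (Fin d))
  subseqs [] = [] ∷ []
  subseqs (x ∷ xs) = let r = subseqs xs in map (x ∷_) r ++ r

  lcsLen : List (Fin d) → List (Fin d) → ℕ
  lcsLen xs ys = foldr _⊔_ 0 (map length (filter (_⊆? ys) (subseqs xs)))

  IsLCS : List (Fin d) → List (Fin d) → List (Fin d) → Set
  IsLCS l xs ys = l ⊆ xs × l ⊆ ys ×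
    (∀ l' → l' ⊆ xs → l' ⊆ ys → length l' ℕ.≤ length l)

  ulam : List (Fin d) → List (Fin d) → ℕ
  ulam π₁ π₂ = d ∸ lcsLen π₁ π₂

  totalUlam : {n : ℕ} → (Fin n → List (Fin d)) → List (Fin d) → ℕ
  totalUlam {n} S σ = Σ[ n ] (λ i → ulam (S i) σ)

  groupCount : {g : ℕ} → (Fin d → Fin g) → Fin g → List (Fin d) → ℕ
  groupCount grp i P = length (filter (λ x → grp x ≟ i) P)

  Fair : {g : ℕ} → (Fin d → Fin g) → (Fin g → ℚ) → (Fin g → ℚ) → ℕ →
         List (Fin d) → Set
  Fair {g} grp lam mu k σ =
    ∀ (p : ℕ) → k ℕ.≤ p → p ℕ.≤ length σ → ∀ (i : Fin g) →
      (floor (lam i ℚ.* ℕ→ℚ p) ℤ.≤ + groupCount grp i (take p σ)) ×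
      (+ groupCount grp i (take p σ) ℤ.≤ ceiling (mu i ℚ.* ℕ→ℚ p))

  costSym : {n : ℕ} → (Fin n → List (Fin d)) → Fin d → ℕ
  costSym {n} ℓ a = countFin n (λ i → ¬? (a ∈? ℓ i))

  activeSet : {n : ℕ} → ℚ → (Fin n → List (Fin d)) → List (Fin d)
  activeSet {n} α ℓ = filter (λ a → α ℚ.* ℕ→ℚ n ℚ.<? ℕ→ℚ (costSym ℓ a)) (allFin d)

  before : List (Fin d) → Fin d → Fin d → Bool
  before [] a b = false
  before (x ∷ xs) a b =
    if does (x ≟d a) then does (b ∈? xs)
    else (if does (x ≟d b) then false else before xs a b)

  Edge : {n : ℕ} → (Fin n → List (Fin d)) → ℚ → Fin d → Fin d → Set
  Edge {n} S α a b =
    (1ℚ ℚ.- ℕ→ℚ 2 ℚ.* α) ℚ.* ℕ→ℚ n ℚ.≤ ℕ→ℚ (countFin n (λ i → before (S i) a b Bool.≟ true))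

  PathEdges : (Fin d → Fin d → Set) → Fin d → List (Fin d) → Fin d → Set
  PathEdges E x [] z = E x z
  PathEdges E x (y ∷ ys) z = E x y × PathEdges E y ys z

  IsCycle : (Fin d → Fin d → Set) → (Fin d → Bool) → List (Fin d) → Set
  IsCycle E P [] = ⊥
  IsCycle E P (v ∷ vs) =
    Unique (v ∷ vs) × (∀ x → x ∈ (v ∷ vs) → P x ≡ true) × PathEdges E v vs v

  OnCycle : (Fin d → Fin d → Set) → (Fin d → Bool) → Fin d → Set
  OnCycle E P v = ∃ λ C → IsCycle E P C × v ∈ C

  ShortestCycleThrough : (Fin d → Fin d → Set) → (Fin d → Bool) → Fin d → List (Fin d) → Set
  ShortestCycleThrough E P v C =
    IsCycle E P C × v ∈ C × (∀ C' → IsCycle E P C' → v ∈ C' → length C ℕ.≤ length C')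

  -- one step of the cycle-deletion loop, processing vertex v:
  -- P is the current vertex set, P' the vertex set afterwards
  Step : (Fin d → Fin d → Set) → Fin d → (Fin d → Bool) → (Fin d → Bool) → Set
  Step E v P P' =
    ((P v ≡ false ⊎ ¬ OnCycle E P v) × (∀ x → P' x ≡ P x))
    ⊎ (∃ λ C → ShortestCycleThrough E P v C ×
               (∀ x → P' x ≡ (P x ∧ not (does (x ∈? C)))))

  -- a run of the loop over v = 1,…,d in turn: run j is the vertex set
  -- after processing the first j vertices
  IsRun : (Fin d → Fin d → Set) → (Fin (suc d) → (Fin d → Bool)) → Set
  IsRun E run = (∀ x → run Fin.zero x ≡ true) ×
                (∀ (v : Fin d) → Step E v (run (inject₁ v)) (run (Fin.suc v)))

  IsTopOrder : (Fin d → Fin d → Set) → (Fin d → Bool) → List (Fin d) → Set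
  IsTopOrder E P σpar =
    Unique σpar × (∀ x → (x ∈ σpar) ⇔ (P x ≡ true)) ×
    (∀ a b → P a ≡ true → P b ≡ true → E a b → before σpar a b ≡ true)

{-# OPTIONS --safe #-}
-- Lazy symbols (cost ≤ αn) are ordered alike by σ* and by the graph H. If a precedes b in σ*,
-- every ranking putting b first misses a or b in its LCS with σ*, so at most 2αn do and
-- a → b is an edge; an edge between lazy symbols pointing backwards in σ* would need
-- (1 - 2α)n ≤ cost a + cost b ≤ 2αn. Consequently
-- * every cycle has a backward edge y → x, whose endpoints have total cost ≥ (1 - 2α)n, so one
--   of them is active and the active symbols of the cycle have total cost ≥ (1 - 4α)n;
-- * a shortest cycle through v has no three consecutive lazy vertices (the middle one could be
--   short-cut), so with k active vertices it has at most 2k + 1 lazy ones.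
-- Hence every deleted cycle C, and so the whole deleted set, satisfies
-- n·|C| ≤ (3 + 4α)·n·k + (cost of its active symbols).
-- The surviving lazy symbols appear in σ̄_par in σ*-order, so an LCS X of σ̄ and σ̄_par is at least
-- as long as them, and the lazy symbols of X lying in ℓπ form a common subsequence of π and σ̄.
-- Summing over π and comparing with OPT = Σπ #(lazy symbols missing from ℓπ) + (cost of the
-- active symbols) gives Σπ U(π, σ̄) ≤ OPT + 2n·#(active survivors) + (3 + 4α)n·#(active deleted)
-- ≤ OPT + (3 + 4α)n|A|, and n|A| ≤ β·OPT with 3 + 4α ≤ 3(1 + 8α) concludes.

module Submission where

open import Defs
open import Data.Nat as ℕ using (ℕ; suc)
open import Data.Fin using (Fin; fromℕ)
open import Data.Integer using (+_)
open import Data.Rational as ℚ using (ℚ; _/_; 0ℚ; 1ℚ)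
open import Data.List using (List; length)
open import Data.Bool using (Bool)
open import Relation.Binary.PropositionalEquality using (_≡_)
open import Function using (Injective)

open import Data.Nat using (zero; _+_; _*_; _∸_; _≤_; _<_; z≤n; s≤s)
import Data.Nat.Properties as ℕP
open import Data.Nat.ListAction using (sum)
open import Data.Nat.ListAction.Properties using (sum-++)
open import Data.Nat.Tactic.RingSolver using (solve-∀)
import Data.Nat.Coprimality as Coprime
import Data.Integer as ℤ
import Data.Integer.Properties as ℤP
import Data.Rational.Properties as ℚP
open import Data.Rational.Solver using () renaming (module +-*-Solver to QS)
import Algebra.Properties.Semiring.Sum ℕP.+-*-semiring as ∑
import Data.Fin as Fin
open import Data.Fin.Properties using (suc-injective)
open import Data.Fin.Induction using (<-weakInduction)
import Data.Bool as Bool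
open import Data.Bool using (true; false; not; _∧_; _∨_; T)
open import Data.Bool.Properties using (not-involutive; T-≡)
open import Data.Product using (∃; _×_; _,_; proj₁; proj₂)
open import Data.Sum using (_⊎_; inj₁; inj₂; [_,_]′)
open import Data.Empty using (⊥; ⊥-elim)
open import Function using (_∘_; const)
open import Function.Bundles using (Equivalence; mk⇔)
open import Relation.Nullary using (¬_; Dec; yes; no; does)
open import Relation.Nullary.Decidable using (does-⇔; dec-false; dec-true; T?; toSum)
open import Relation.Binary.Definitions using (DecidableEquality)
open import Relation.Binary.PropositionalEquality
  using (setoid; refl; sym; trans; cong; cong₂; subst; subst₂; _≢_; module ≡-Reasoning)
open import Data.List using ([]; _∷_; _++_; map; filter; allFin; foldr)
open import Data.List.Properties using (map-tabulate; map-++; ++-assoc; ++-identityʳ)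
open import Data.List.Membership.Propositional using (_∈_)
open import Data.List.Membership.Propositional.Properties
  using (∈-map⁺; ∈-map⁻; ∈-++⁺ˡ; ∈-++⁺ʳ; ∈-++⁻; ∈-filter⁺; ∈-filter⁻; ∈-∃++; ∈-allFin)
open import Data.List.Relation.Unary.Any using (here; there)
open import Data.List.Relation.Unary.AllPairs using (_∷_)
open import Data.List.Relation.Unary.Unique.Propositional using (Unique)
open import Data.List.Relation.Unary.Unique.Propositional.Properties using (Unique[x∷xs]⇒x∉xs; allFin⁺)
open import Data.List.Relation.Binary.Sublist.Propositional using (_⊆_; []; _∷_; _∷ʳ_; ⊆-refl; ⊆-trans; minimum)
open import Data.List.Relation.Binary.Sublist.Propositional.Properties using (filter-⊆; All-resp-⊆; Any-resp-⊆)
open import Data.List.Relation.Binary.Permutation.Propositional using (_↭_; ↭-sym; ↭⇒↭ₛ)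
open import Data.List.Relation.Binary.Permutation.Propositional.Properties using (∈-resp-↭; ↭-length; ++-comm)
open import Data.List.Relation.Binary.Permutation.Setoid.Properties using (Unique-resp-↭)

does-true⇒ : ∀ {A : Set} (a? : Dec A) → does a? ≡ true → A
does-true⇒ (yes a) _ = a

does-false⇒ : ∀ {A : Set} (a? : Dec A) → does a? ≡ false → ¬ A
does-false⇒ (no ¬a) _ = ¬a

⟦_⟧ : Bool → ℕ
⟦ true ⟧ = 1
⟦ false ⟧ = 0

*-distribʳ-⟦∨⟧ : ∀ q q' c → q ∧ q' ≡ false → ⟦ q ∨ q' ⟧ * c ≡ ⟦ q ⟧ * c + ⟦ q' ⟧ * c
*-distribʳ-⟦∨⟧ false q' c _ = refl
*-distribʳ-⟦∨⟧ true false c _ = sym (ℕP.+-identityʳ (c + 0))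

1≤⟦⟧+⟦⟧ : ∀ a b → (a ≡ false → b ≡ false → ⊥) → 1 ≤ ⟦ a ⟧ + ⟦ b ⟧
1≤⟦⟧+⟦⟧ true _ _ = s≤s z≤n
1≤⟦⟧+⟦⟧ false true _ = s≤s z≤n
1≤⟦⟧+⟦⟧ false false both = ⊥-elim (both refl refl)

not-∧-disjoint : ∀ p c → (c ≡ true → p ≡ true) → not p ∧ c ≡ false
not-∧-disjoint true _ _ = refl
not-∧-disjoint false false _ = refl
not-∧-disjoint false true c⇒p with () ← c⇒p refl

T-∧⁻ : ∀ {a b} → T (a ∧ b) → a ≡ true × b ≡ true
T-∧⁻ {true} {true} _ = refl , refl

T-not⁻ : ∀ {a} → T (not a) → a ≡ false
T-not⁻ {false} _ = refl

not-∧-not : ∀ p c → not (p ∧ not c) ≡ not p ∨ c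
not-∧-not false c = refl
not-∧-not true c = not-involutive c

Σ-suc : ∀ n (f : Fin (suc n) → ℕ) → Σ[ suc n ] f ≡ f Fin.zero + Σ[ n ] (f ∘ Fin.suc)
Σ-suc n f = cong (λ xs → f Fin.zero + sum xs)
  (trans (map-tabulate Fin.suc f) (sym (map-tabulate (λ i → i) (f ∘ Fin.suc))))

Σ≡∑ : ∀ n (f : Fin n → ℕ) → Σ[ n ] f ≡ ∑.sum f
Σ≡∑ zero f = refl
Σ≡∑ (suc n) f = trans (Σ-suc n f) (cong (λ s → f Fin.zero + s) (Σ≡∑ n (f ∘ Fin.suc)))

Σ-cong : ∀ n {f g : Fin n → ℕ} → (∀ i → f i ≡ g i) → Σ[ n ] f ≡ Σ[ n ] g
Σ-cong n {f} {g} f≗g = trans (Σ≡∑ n f) (trans (∑.sum-cong-≗ f≗g) (sym (Σ≡∑ n g)))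

Σ-distrib-+ : ∀ n (f g : Fin n → ℕ) → Σ[ n ] (λ i → f i + g i) ≡ Σ[ n ] f + Σ[ n ] g
Σ-distrib-+ n f g = begin
  Σ[ n ] (λ i → f i + g i)      ≡⟨ Σ≡∑ n _ ⟩
  ∑.sum (λ i → f i + g i)       ≡⟨ ∑.∑-distrib-+ f g ⟩
  ∑.sum f + ∑.sum g             ≡⟨ sym (cong₂ _+_ (Σ≡∑ n f) (Σ≡∑ n g)) ⟩
  Σ[ n ] f + Σ[ n ] g           ∎
  where open ≡-Reasoning

Σ-comm : ∀ m n (f : Fin m → Fin n → ℕ) →
  Σ[ m ] (λ i → Σ[ n ] (f i)) ≡ Σ[ n ] (λ j → Σ[ m ] (λ i → f i j))
Σ-comm m n f = begin
  Σ[ m ] (λ i → Σ[ n ] (f i))                 ≡⟨ trans (Σ≡∑ m _) (∑.sum-cong-≗ (λ i → Σ≡∑ n (f i))) ⟩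
  ∑.sum (λ i → ∑.sum (f i))                   ≡⟨ ∑.∑-comm f ⟩
  ∑.sum (λ j → ∑.sum (λ i → f i j))
    ≡⟨ sym (trans (Σ≡∑ n _) (∑.sum-cong-≗ (λ j → Σ≡∑ m (λ i → f i j)))) ⟩
  Σ[ n ] (λ j → Σ[ m ] (λ i → f i j))         ∎
  where open ≡-Reasoning

*-distribˡ-Σ : ∀ n k (f : Fin n → ℕ) → k * Σ[ n ] f ≡ Σ[ n ] (λ i → k * f i)
*-distribˡ-Σ n k f = trans (cong (k *_) (Σ≡∑ n f)) (trans (∑.*-distribˡ-sum k f) (sym (Σ≡∑ n _)))

Σ-const : ∀ n k → Σ[ n ] (const k) ≡ n * k
Σ-const zero k = refl
Σ-const (suc n) k = trans (Σ-suc n (const k)) (cong (λ s → k + s) (Σ-const n k))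

Σ-mono : ∀ n {f g : Fin n → ℕ} → (∀ i → f i ≤ g i) → Σ[ n ] f ≤ Σ[ n ] g
Σ-mono zero f≤g = z≤n
Σ-mono (suc n) {f} {g} f≤g rewrite Σ-suc n f | Σ-suc n g =
  ℕP.+-mono-≤ (f≤g Fin.zero) (Σ-mono n (f≤g ∘ Fin.suc))

Σ-δ : ∀ n (g : Fin n → ℕ) y → Σ[ n ] (λ x → ⟦ does (x Fin.≟ y) ⟧ * g x) ≡ g y
Σ-δ (suc n) g Fin.zero = begin
  Σ[ suc n ] (λ x → ⟦ does (x Fin.≟ Fin.zero) ⟧ * g x)   ≡⟨ Σ-suc n (λ x → ⟦ does (x Fin.≟ Fin.zero) ⟧ * g x) ⟩
  g Fin.zero + 0 + Σ[ n ] (const 0)                     ≡⟨ cong₂ _+_ (ℕP.+-identityʳ _) (trans (Σ-const n 0) (ℕP.*-zeroʳ n)) ⟩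
  g Fin.zero + 0                                        ≡⟨ ℕP.+-identityʳ _ ⟩
  g Fin.zero                                            ∎
  where open ≡-Reasoning
Σ-δ (suc n) g (Fin.suc y) = begin
  Σ[ suc n ] (λ x → ⟦ does (x Fin.≟ Fin.suc y) ⟧ * g x)        ≡⟨ Σ-suc n (λ x → ⟦ does (x Fin.≟ Fin.suc y) ⟧ * g x) ⟩
  Σ[ n ] (λ x → ⟦ does (Fin.suc x Fin.≟ Fin.suc y) ⟧ * g (Fin.suc x))
    ≡⟨ Σ-cong n (λ x → cong (λ b → ⟦ b ⟧ * g (Fin.suc x))
         (does-⇔ (mk⇔ suc-injective (cong Fin.suc)) (Fin.suc x Fin.≟ Fin.suc y) (x Fin.≟ y))) ⟩
  Σ[ n ] (λ x → ⟦ does (x Fin.≟ y) ⟧ * g (Fin.suc x))          ≡⟨ Σ-δ n (g ∘ Fin.suc) y ⟩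
  g (Fin.suc y)                                               ∎
  where open ≡-Reasoning

length-filter≡Σ : ∀ {A : Set} {P : A → Set} (P? : (x : A) → Dec (P x)) xs →
  length (filter P? xs) ≡ sum (map (λ x → ⟦ does (P? x) ⟧) xs)
length-filter≡Σ P? [] = refl
length-filter≡Σ P? (x ∷ xs) with does (P? x)
... | true  = cong suc (length-filter≡Σ P? xs)
... | false = length-filter≡Σ P? xs

∈⇒≤sum : ∀ {A : Set} (f : A → ℕ) {x xs} → x ∈ xs → f x ≤ sum (map f xs)
∈⇒≤sum f (here refl) = ℕP.m≤m+n _ _
∈⇒≤sum f {xs = y ∷ _} (there x∈) = ℕP.≤-trans (∈⇒≤sum f x∈) (ℕP.m≤n+m _ (f y))

∈²⇒≤sum : ∀ {A : Set} (f : A → ℕ) {x y xs} → x ∈ xs → y ∈ xs → x ≢ y → f x + f y ≤ sum (map f xs)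
∈²⇒≤sum f (here refl) (here refl) x≢y = ⊥-elim (x≢y refl)
∈²⇒≤sum f (here refl) (there y∈) _ = ℕP.+-monoʳ-≤ (f _) (∈⇒≤sum f y∈)
∈²⇒≤sum f {x} {y} {_ ∷ xs} (there x∈) (here refl) _ =
  subst (_≤ f y + sum (map f xs)) (ℕP.+-comm (f y) (f x)) (ℕP.+-monoʳ-≤ (f y) (∈⇒≤sum f x∈))
∈²⇒≤sum f {xs = z ∷ _} (there x∈) (there y∈) x≢y = ℕP.≤-trans (∈²⇒≤sum f x∈ y∈ x≢y) (ℕP.m≤n+m _ (f z))

sum-map-++ : ∀ {A : Set} (g : A → ℕ) xs ys → sum (map g (xs ++ ys)) ≡ sum (map g xs) + sum (map g ys)
sum-map-++ g xs ys = trans (cong sum (map-++ g xs ys)) (sum-++ (map g xs) (map g ys))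

sum-map-const1 : ∀ {A : Set} (xs : List A) → sum (map (const 1) xs) ≡ length xs
sum-map-const1 [] = refl
sum-map-const1 (_ ∷ xs) = cong suc (sum-map-const1 xs)

module _ {d : ℕ} where
  open import Data.List.Membership.DecPropositional (Fin._≟_ {n = d}) using (_∈?_)

  Σ⟨_⟩_ : (Fin d → Bool) → (Fin d → ℕ) → ℕ
  Σ⟨ Q ⟩ f = Σ[ d ] (λ x → ⟦ Q x ⟧ * f x)

  _∈ᵇ_ : Fin d → List (Fin d) → Bool
  x ∈ᵇ xs = does (x ∈? xs)

  ∈ᵇ⇒∈ : ∀ {x xs} → x ∈ᵇ xs ≡ true → x ∈ xs
  ∈ᵇ⇒∈ {x} {xs} = does-true⇒ (x ∈? xs)

  ∈⇒∈ᵇ : ∀ {x xs} → x ∈ xs → x ∈ᵇ xs ≡ true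
  ∈⇒∈ᵇ {x} {xs} = dec-true (x ∈? xs)

  Unique-ranking : ∀ {σ} → IsRanking σ → Unique σ
  Unique-ranking σ↭ = Unique-resp-↭ (setoid (Fin d)) (↭⇒↭ₛ (↭-sym σ↭)) (allFin⁺ d)

  ∈-ranking : ∀ {σ} → IsRanking σ → ∀ x → x ∈ σ
  ∈-ranking σ↭ x = ∈-resp-↭ (↭-sym σ↭) (∈-allFin {d} x)

  Σ⟨⟩-cong : ∀ {Q Q' : Fin d → Bool} {f} → (∀ x → Q x ≡ Q' x) → Σ⟨ Q ⟩ f ≡ Σ⟨ Q' ⟩ f
  Σ⟨⟩-cong {f = f} Q≗Q' = Σ-cong d (λ x → cong (λ b → ⟦ b ⟧ * f x) (Q≗Q' x))

  Σ⟨false⟩ : ∀ f → Σ⟨ const false ⟩ f ≡ 0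
  Σ⟨false⟩ f = trans (Σ-const d 0) (ℕP.*-zeroʳ d)

  Σ⟨⟩-∨ : ∀ (Q Q' : Fin d → Bool) f → (∀ x → Q x ∧ Q' x ≡ false) →
    Σ⟨ (λ x → Q x ∨ Q' x) ⟩ f ≡ Σ⟨ Q ⟩ f + Σ⟨ Q' ⟩ f
  Σ⟨⟩-∨ Q Q' f disjoint = trans (Σ-cong d (λ x → *-distribʳ-⟦∨⟧ (Q x) (Q' x) (f x) (disjoint x))) (Σ-distrib-+ d _ _)

  Σ⟨true⟩ : ∀ {Q : Fin d → Bool} f → (∀ x → Q x ≡ true) → Σ⟨ Q ⟩ f ≡ Σ[ d ] f
  Σ⟨true⟩ f all = Σ-cong d (λ x → trans (cong (λ b → ⟦ b ⟧ * f x) (all x)) (ℕP.+-identityʳ (f x)))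

  Σ⟨⟩-split : ∀ (Q : Fin d → Bool) f → Σ[ d ] f ≡ Σ⟨ Q ⟩ f + Σ⟨ not ∘ Q ⟩ f
  Σ⟨⟩-split Q f = trans (Σ-cong d (λ x → split (Q x) (f x))) (Σ-distrib-+ d _ _)
    where
    split : ∀ q c → c ≡ ⟦ q ⟧ * c + ⟦ not q ⟧ * c
    split false c = sym (ℕP.+-identityʳ c)
    split true c = sym (trans (ℕP.+-identityʳ (c + 0)) (ℕP.+-identityʳ c))

  Σ⟨∈ᵇ⟩ : ∀ {xs} → Unique xs → ∀ f → Σ⟨ (_∈ᵇ xs) ⟩ f ≡ sum (map f xs)
  Σ⟨∈ᵇ⟩ {[]} _ f = Σ⟨false⟩ f
  Σ⟨∈ᵇ⟩ {y ∷ xs} (y∉xs ∷ uxs) f = begin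
    Σ⟨ (_∈ᵇ (y ∷ xs)) ⟩ f                                        ≡⟨ Σ-cong d (λ x → split (x Fin.≟ y) (x ∈? xs)) ⟩
    Σ[ d ] (λ x → ⟦ does (x Fin.≟ y) ⟧ * f x + ⟦ x ∈ᵇ xs ⟧ * f x)  ≡⟨ Σ-distrib-+ d _ _ ⟩
    Σ[ d ] (λ x → ⟦ does (x Fin.≟ y) ⟧ * f x) + Σ⟨ (_∈ᵇ xs) ⟩ f    ≡⟨ cong₂ _+_ (Σ-δ d f y) (Σ⟨∈ᵇ⟩ uxs f) ⟩
    f y + sum (map f xs)                                           ∎
    where
    open ≡-Reasoning
    split : ∀ {x} (x≟y : Dec (x ≡ y)) (x∈? : Dec (x ∈ xs)) →
      ⟦ does x≟y ∨ does x∈? ⟧ * f x ≡ ⟦ does x≟y ⟧ * f x + ⟦ does x∈? ⟧ * f x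
    split (yes refl) x∈? = *-distribʳ-⟦∨⟧ true (does x∈?) (f y) (dec-false x∈? (Unique[x∷xs]⇒x∉xs (y∉xs ∷ uxs)))
    split (no _) x∈? = refl

  Σ⟨∈ᵇ⟩-↭ : ∀ {xs ys} → xs ↭ ys → Unique ys → ∀ f → Σ⟨ (_∈ᵇ xs) ⟩ f ≡ sum (map f ys)
  Σ⟨∈ᵇ⟩-↭ {xs} {ys} xs↭ys uys f = trans
    (Σ⟨⟩-cong (λ x → does-⇔ (mk⇔ (∈-resp-↭ xs↭ys) (∈-resp-↭ (↭-sym xs↭ys))) (x ∈? xs) (x ∈? ys)))
    (Σ⟨∈ᵇ⟩ uys f)

ℕ→ℚ≡mkℚ : ∀ m → ℕ→ℚ m ≡ ℚ.mkℚ (+ m) 0 (Coprime.sym (Coprime.1-coprimeTo m))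
ℕ→ℚ≡mkℚ m = ℚP.normalize-coprime (Coprime.sym (Coprime.1-coprimeTo m))

ℕ→ℚ-+ : ∀ m k → ℕ→ℚ (m + k) ≡ ℕ→ℚ m ℚ.+ ℕ→ℚ k
ℕ→ℚ-+ m k rewrite ℕ→ℚ≡mkℚ m | ℕ→ℚ≡mkℚ k =
  cong (_/ 1) (sym (cong₂ ℤ._+_ (ℤP.*-identityʳ (+ m)) (ℤP.*-identityʳ (+ k))))

ℕ→ℚ-+₃ : ∀ a b c → ℕ→ℚ (a + b + c) ≡ ℕ→ℚ a ℚ.+ ℕ→ℚ b ℚ.+ ℕ→ℚ c
ℕ→ℚ-+₃ a b c = trans (ℕ→ℚ-+ (a + b) c) (cong (ℚ._+ ℕ→ℚ c) (ℕ→ℚ-+ a b))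

ℕ→ℚ-* : ∀ m k → ℕ→ℚ (m * k) ≡ ℕ→ℚ m ℚ.* ℕ→ℚ k
ℕ→ℚ-* m k rewrite ℕ→ℚ≡mkℚ m | ℕ→ℚ≡mkℚ k = cong (_/ 1) (ℤP.pos-* m k)

ℕ→ℚ-mono-≤ : ∀ {m k} → m ≤ k → ℕ→ℚ m ℚ.≤ ℕ→ℚ k
ℕ→ℚ-mono-≤ {m} {k} m≤k rewrite ℕ→ℚ≡mkℚ m | ℕ→ℚ≡mkℚ k =
  ℚ.*≤* (subst₂ ℤ._≤_ (sym (ℤP.*-identityʳ (+ m))) (sym (ℤP.*-identityʳ (+ k))) (ℤ.+≤+ m≤k))

ℕ→ℚ-nonNeg : ∀ m → 0ℚ ℚ.≤ ℕ→ℚ m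
ℕ→ℚ-nonNeg m = ℕ→ℚ-mono-≤ {0} {m} z≤n

-- Order of occurrence in a list

Unique-resp-⊇ : ∀ {A : Set} {xs ys : List A} → xs ⊆ ys → Unique ys → Unique xs
Unique-resp-⊇ [] u = u
Unique-resp-⊇ (_ ∷ʳ τ) (_ ∷ u) = Unique-resp-⊇ τ u
Unique-resp-⊇ (refl ∷ τ) (x∉ ∷ u) = All-resp-⊆ τ x∉ ∷ Unique-resp-⊇ τ u

module _ {A : Set} where

  data Precedes : List A → A → A → Set where
    here  : ∀ {a b xs} → b ∈ xs → Precedes (a ∷ xs) a b
    there : ∀ {x a b xs} → x ≢ a → x ≢ b → Precedes xs a b → Precedes (x ∷ xs) a b

  Unique-head≢ : ∀ {y z : A} {ys} → Unique (y ∷ ys) → z ∈ ys → y ≢ z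
  Unique-head≢ u z∈ys refl = Unique[x∷xs]⇒x∉xs u z∈ys

  ∈-tail : ∀ {x z : A} {xs} → z ∈ x ∷ xs → x ≢ z → z ∈ xs
  ∈-tail (here refl) x≢z = ⊥-elim (x≢z refl)
  ∈-tail (there z∈) _ = z∈

  Precedes⇒∈ : ∀ {xs} {a b : A} → Precedes xs a b → a ∈ xs × b ∈ xs
  Precedes⇒∈ (here b∈) = here refl , there b∈
  Precedes⇒∈ (there _ _ p) = let (a∈ , b∈) = Precedes⇒∈ p in there a∈ , there b∈

  Precedes-tail : ∀ {x a b : A} {xs} → x ≢ a → Precedes (x ∷ xs) a b → Precedes xs a b
  Precedes-tail x≢a (here _) = ⊥-elim (x≢a refl)
  Precedes-tail _ (there _ _ p) = p

  Precedes-irrefl : ∀ {xs} {a : A} → Unique xs → ¬ Precedes xs a a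
  Precedes-irrefl u (here a∈) = Unique[x∷xs]⇒x∉xs u a∈
  Precedes-irrefl (_ ∷ u) (there _ _ p) = Precedes-irrefl u p

  Precedes⇒≢ : ∀ {xs} {a b : A} → Unique xs → Precedes xs a b → a ≢ b
  Precedes⇒≢ u a≺b refl = Precedes-irrefl u a≺b

  Precedes-asym : ∀ {xs} {a b : A} → Unique xs → Precedes xs a b → ¬ Precedes xs b a
  Precedes-asym u (here a∈) (here _) = Unique[x∷xs]⇒x∉xs u a∈
  Precedes-asym u (here _) (there _ a≢a _) = a≢a refl
  Precedes-asym u (there _ b≢b _) (here _) = b≢b refl
  Precedes-asym (_ ∷ u) (there _ _ p) (there _ _ q) = Precedes-asym u p q

  Precedes-trans : ∀ {xs} {a b c : A} → Unique xs → Precedes xs a b → Precedes xs b c → Precedes xs a c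
  Precedes-trans u (here a∈) (here _) = ⊥-elim (Unique[x∷xs]⇒x∉xs u a∈)
  Precedes-trans u (here _) (there _ _ q) = here (proj₂ (Precedes⇒∈ q))
  Precedes-trans u (there _ b≢b _) (here _) = ⊥-elim (b≢b refl)
  Precedes-trans (_ ∷ u) (there x≢a _ p) (there _ x≢c q) = there x≢a x≢c (Precedes-trans u p q)

  Precedes-resp-⊆ : ∀ {xs ys} {a b : A} → xs ⊆ ys → Unique ys → Precedes xs a b → Precedes ys a b
  Precedes-resp-⊆ (y ∷ʳ τ) u@(_ ∷ uys) p =
    let p' = Precedes-resp-⊆ τ uys p ; (a∈ , b∈) = Precedes⇒∈ p'
    in there (Unique-head≢ u a∈) (Unique-head≢ u b∈) p'
  Precedes-resp-⊆ (refl ∷ τ) _ (here b∈) = here (Any-resp-⊆ τ b∈)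
  Precedes-resp-⊆ (refl ∷ τ) (_ ∷ uys) (there x≢a x≢b p) = there x≢a x≢b (Precedes-resp-⊆ τ uys p)

module _ {A : Set} (_≟_ : DecidableEquality A) where

  Precedes-total : ∀ {xs} {a b : A} → a ∈ xs → b ∈ xs → a ≢ b → Precedes xs a b ⊎ Precedes xs b a
  Precedes-total {x ∷ xs} {a} {b} a∈ b∈ a≢b with x ≟ a | x ≟ b
  ... | yes refl | yes refl = ⊥-elim (a≢b refl)
  ... | yes refl | no x≢b   = inj₁ (here (∈-tail b∈ x≢b))
  ... | no x≢a   | yes refl = inj₂ (here (∈-tail a∈ x≢a))
  ... | no x≢a   | no x≢b with Precedes-total (∈-tail a∈ x≢a) (∈-tail b∈ x≢b) a≢b
  ...   | inj₁ p = inj₁ (there x≢a x≢b p)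
  ...   | inj₂ p = inj₂ (there x≢b x≢a p)

  ⊆-from-Precedes : ∀ {xs ys : List A} → Unique xs → Unique ys → (∀ {z} → z ∈ xs → z ∈ ys) →
    (∀ {a b} → Precedes xs a b → Precedes ys a b) → xs ⊆ ys
  ⊆-from-Precedes {[]} {ys} _ _ _ _ = minimum ys
  ⊆-from-Precedes {x ∷ xs} {[]} _ _ xs⊆ _ with xs⊆ (here refl)
  ... | ()
  ⊆-from-Precedes {x ∷ xs} {y ∷ ys} uxs@(_ ∷ uxs') uys@(_ ∷ uys') xs⊆ order with x ≟ y
  ... | yes refl = refl ∷ ⊆-from-Precedes uxs' uys' (λ z∈ → ∈-tail (xs⊆ (there z∈)) (Unique-head≢ uxs z∈))
                     (λ p → let x≢a = Unique-head≢ uxs (proj₁ (Precedes⇒∈ p))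
                                x≢b = Unique-head≢ uxs (proj₂ (Precedes⇒∈ p))
                            in Precedes-tail x≢a (order (there x≢a x≢b p)))
  ... | no x≢y = y ∷ʳ ⊆-from-Precedes uxs uys' (λ z∈ → ∈-tail (xs⊆ z∈) (y∉ z∈))
                   (λ p → Precedes-tail (y∉ (proj₁ (Precedes⇒∈ p))) (order p))
    where
    y∉ : ∀ {z} → z ∈ x ∷ xs → y ≢ z
    y∉ (here refl) y≡x = x≢y (sym y≡x)
    y∉ (there z∈) refl with order (here z∈)
    ... | here _ = x≢y refl
    ... | there _ y≢y _ = y≢y refl

≤-foldr-⊔ : ∀ {m ms} → m ∈ ms → m ≤ foldr ℕ._⊔_ 0 ms
≤-foldr-⊔ {ms = m ∷ _} (here refl) = ℕP.m≤m⊔n m _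
≤-foldr-⊔ {ms = m ∷ _} (there m∈) = ℕP.≤-trans (≤-foldr-⊔ m∈) (ℕP.m≤n⊔m m _)

foldr-⊔-attained : ∀ ms → foldr ℕ._⊔_ 0 ms ≡ 0 ⊎ foldr ℕ._⊔_ 0 ms ∈ ms
foldr-⊔-attained [] = inj₁ refl
foldr-⊔-attained (m ∷ ms) with ℕP.⊔-sel m (foldr ℕ._⊔_ 0 ms) | foldr-⊔-attained ms
... | inj₁ ≡m | _ = inj₂ (here ≡m)
... | inj₂ ≡max | inj₁ ≡0 = inj₁ (trans ≡max ≡0)
... | inj₂ ≡max | inj₂ max∈ = inj₂ (subst (_∈ m ∷ ms) (sym ≡max) (there max∈))

module _ {d : ℕ} where
  open import Data.List.Membership.DecPropositional (Fin._≟_ {n = d}) using (_∈?_)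
  open import Data.List.Relation.Binary.Sublist.DecPropositional (Fin._≟_ {n = d}) using (_⊆?_)

  before⇒Precedes : ∀ xs {a b : Fin d} → before xs a b ≡ true → Precedes xs a b
  before⇒Precedes (x ∷ xs) {a} {b} e with x Fin.≟ a
  ... | yes refl = here (does-true⇒ (b ∈? xs) e)
  ... | no x≢a with x Fin.≟ b
  ...   | no x≢b = there x≢a x≢b (before⇒Precedes xs e)

  Precedes⇒before : ∀ {xs} {a b : Fin d} → Precedes xs a b → before xs a b ≡ true
  Precedes⇒before {a ∷ xs} {b = b} (here b∈) with a Fin.≟ a
  ... | yes _ = dec-true (b ∈? xs) b∈
  ... | no a≢a = ⊥-elim (a≢a refl)
  Precedes⇒before {x ∷ _} {a} {b} (there x≢a x≢b p) with x Fin.≟ a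
  ... | yes x≡a = ⊥-elim (x≢a x≡a)
  ... | no _ with x Fin.≟ b
  ...   | yes x≡b = ⊥-elim (x≢b x≡b)
  ...   | no _ = Precedes⇒before p

  subseqs-complete : ∀ {l xs : List (Fin d)} → l ⊆ xs → l ∈ subseqs xs
  subseqs-complete [] = here refl
  subseqs-complete {xs = x ∷ xs} (x ∷ʳ τ) = ∈-++⁺ʳ (map (x ∷_) (subseqs xs)) (subseqs-complete τ)
  subseqs-complete (refl ∷ τ) = ∈-++⁺ˡ (∈-map⁺ (_ ∷_) (subseqs-complete τ))

  subseqs-sound : ∀ {l : List (Fin d)} xs → l ∈ subseqs xs → l ⊆ xs
  subseqs-sound [] (here refl) = []
  subseqs-sound (x ∷ xs) l∈ with ∈-++⁻ (map (x ∷_) (subseqs xs)) l∈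
  ... | inj₂ l∈' = x ∷ʳ subseqs-sound xs l∈'
  ... | inj₁ l∈' with ∈-map⁻ (x ∷_) l∈'
  ...   | _ , l'∈ , refl = refl ∷ subseqs-sound xs l'∈

  lcsLen-≥ : ∀ {l xs ys : List (Fin d)} → l ⊆ xs → l ⊆ ys → length l ≤ lcsLen xs ys
  lcsLen-≥ {xs = xs} {ys} l⊆xs l⊆ys =
    ≤-foldr-⊔ (∈-map⁺ length (∈-filter⁺ (_⊆? ys) (subseqs-complete l⊆xs) l⊆ys))

  lcsLen-witness : ∀ (xs ys : List (Fin d)) → ∃ λ l → l ⊆ xs × l ⊆ ys × lcsLen xs ys ≡ length l
  lcsLen-witness xs ys with foldr-⊔-attained (map length (filter (_⊆? ys) (subseqs xs)))
  ... | inj₁ ≡0 = [] , minimum xs , minimum ys , ≡0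
  ... | inj₂ ∈lengths with ∈-map⁻ length ∈lengths
  ...   | l , l∈ , eq = let (l∈subseqs , l⊆ys) = ∈-filter⁻ (_⊆? ys) l∈
                        in l , subseqs-sound xs l∈subseqs , l⊆ys , eq

-- Runs of three

data ThreeInARow {A : Set} (P : A → Set) : List A → Set where
  here  : ∀ {a b c xs} → P a → P b → P c → ThreeInARow P (a ∷ b ∷ c ∷ xs)
  there : ∀ {x xs} → ThreeInARow P xs → ThreeInARow P (x ∷ xs)

ThreeInARow-++ˡ : ∀ {A : Set} {P : A → Set} {xs} ys → ThreeInARow P xs → ThreeInARow P (xs ++ ys)
ThreeInARow-++ˡ ys (here pa pb pc) = here pa pb pc
ThreeInARow-++ˡ ys (there r) = there (ThreeInARow-++ˡ ys r)

module _ {A : Set} (f : A → Bool) where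
  private
    step : ∀ {F T} k → k ≤ 2 → F ≤ 2 * T + 2 → k + F ≤ 2 * (1 + T) + 2
    step {F} {T} k k≤2 F≤ = ℕP.≤-trans (ℕP.+-mono-≤ k≤2 F≤) (ℕP.≤-reflexive (lemma T))
      where
      lemma : ∀ T → 2 + (2 * T + 2) ≡ 2 * (1 + T) + 2
      lemma = solve-∀

  #true #false : List A → ℕ
  #true xs = sum (map (λ x → ⟦ f x ⟧) xs)
  #false xs = sum (map (λ x → ⟦ not (f x) ⟧) xs)

  #false≤2*#true+2 : ∀ xs → ¬ ThreeInARow (λ x → f x ≡ false) xs → #false xs ≤ 2 * #true xs + 2
  #false≤2*#true+2 [] _ = z≤n
  #false≤2*#true+2 (x ∷ xs) no-run with f x in fx
  ... | true = step 0 z≤n (#false≤2*#true+2 xs (λ r → no-run (there r)))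
  #false≤2*#true+2 (x ∷ []) no-run | false = s≤s z≤n
  #false≤2*#true+2 (x ∷ y ∷ ys) no-run | false with f y in fy
  ... | true = step 1 (s≤s z≤n) (#false≤2*#true+2 ys (λ r → no-run (there (there r))))
  #false≤2*#true+2 (x ∷ y ∷ []) no-run | false | false = ℕP.≤-refl
  #false≤2*#true+2 (x ∷ y ∷ z ∷ zs) no-run | false | false with f z in fz
  ... | true = step 2 ℕP.≤-refl (#false≤2*#true+2 zs (λ r → no-run (there (there (there r)))))
  ... | false = ⊥-elim (no-run (here fx fy fz))

  #true+#false : ∀ xs → #true xs + #false xs ≡ sum (map (const 1) xs)
  #true+#false [] = refl
  #true+#false (x ∷ xs) with f x
  ... | true = cong suc (#true+#false xs)
  ... | false = trans (ℕP.+-suc (#true xs) (#false xs)) (cong suc (#true+#false xs))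

  #false≤2*#true+1-cyclic : ∀ v ws → ¬ ThreeInARow (λ x → f x ≡ false) (v ∷ ws ++ v ∷ []) →
    #false (v ∷ ws) ≤ 2 * #true (v ∷ ws) + 1
  #false≤2*#true+1-cyclic v ws no-run = bound (f v) (#false ws) (#true ws) ws-bound
    (subst₂ _≤_ (cong (λ s → ⟦ not (f v) ⟧ + s) (sum-map-++ (λ x → ⟦ not (f x) ⟧) ws (v ∷ [])))
                (cong (λ s → 2 * (⟦ f v ⟧ + s) + 2) (sum-map-++ (λ x → ⟦ f x ⟧) ws (v ∷ [])))
                (#false≤2*#true+2 (v ∷ ws ++ v ∷ []) no-run))
    where
    ws-bound : #false ws ≤ 2 * #true ws + 2
    ws-bound = #false≤2*#true+2 ws (λ r → no-run (there (ThreeInARow-++ˡ (v ∷ []) r)))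
    bound : ∀ b F T → F ≤ 2 * T + 2 →
      ⟦ not b ⟧ + (F + (⟦ not b ⟧ + 0)) ≤ 2 * (⟦ b ⟧ + (T + (⟦ b ⟧ + 0))) + 2 →
      ⟦ not b ⟧ + F ≤ 2 * (⟦ b ⟧ + T) + 1
    bound true F T F≤ _ = ℕP.≤-trans F≤ (ℕP.≤-trans (ℕP.n≤1+n _) (ℕP.≤-reflexive (lemma T)))
      where
      lemma : ∀ T → suc (2 * T + 2) ≡ 2 * (1 + T) + 1
      lemma = solve-∀
    bound false F T _ F≤ = ℕP.+-cancelʳ-≤ 1 (suc F) (2 * T + 1) (subst₂ _≤_ (lhs F) (rhs T) F≤)
      where
      lhs : ∀ F → 1 + (F + 1) ≡ suc F + 1
      lhs = solve-∀
      rhs : ∀ T → 2 * (T + 0) + 2 ≡ 2 * T + 1 + 1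
      rhs = solve-∀

-- Cycles

module Cycles {d : ℕ} (E : Fin d → Fin d → Set) where

  PathEdges-snoc : ∀ {a b c} ws → PathEdges E a ws b → E b c → PathEdges E a (ws ++ b ∷ []) c
  PathEdges-snoc [] eab ebc = eab , ebc
  PathEdges-snoc (w ∷ ws) (eaw , p) ebc = eaw , PathEdges-snoc ws p ebc

  Closed : List (Fin d) → Set
  Closed [] = ⊥
  Closed (c ∷ cs) = PathEdges E c cs c

  Closed-rotate₁ : ∀ c cs → Closed (c ∷ cs) → Closed (cs ++ c ∷ [])
  Closed-rotate₁ c [] ecc = ecc
  Closed-rotate₁ c (x ∷ cs) (ecx , p) = PathEdges-snoc cs p ecx

  Closed-rotate : ∀ pre v post → Closed (pre ++ v ∷ post) → Closed (v ∷ post ++ pre)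
  Closed-rotate [] v post closed = subst Closed (cong (v ∷_) (sym (++-identityʳ post))) closed
  Closed-rotate (q ∷ pre) v post closed =
    subst Closed (cong (v ∷_) (++-assoc post (q ∷ []) pre))
      (Closed-rotate pre v (post ++ q ∷ [])
        (subst Closed (++-assoc pre (v ∷ post) (q ∷ [])) (Closed-rotate₁ q (pre ++ v ∷ post) closed)))

  IsCycle⇒present : ∀ {P C x} → IsCycle E P C → x ∈ C → P x ≡ true
  IsCycle⇒present {C = _ ∷ _} (_ , present , _) = present _

  module _ {P : Fin d → Bool} {v : Fin d} where

    rotate-shortest : ∀ {C} → ShortestCycleThrough E P v C →
      ∃ λ ws → ShortestCycleThrough E P v (v ∷ ws) × C ↭ v ∷ ws
    rotate-shortest {c ∷ cs} ((uC , inP , closed) , v∈C , shortest) with ∈-∃++ v∈C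
    ... | pre , post , C≡ = post ++ pre , (cycle , here refl , shortest') , C↭
      where
      C↭ : c ∷ cs ↭ v ∷ post ++ pre
      C↭ = subst (_↭ v ∷ post ++ pre) (sym C≡) (++-comm pre (v ∷ post))
      cycle : IsCycle E P (v ∷ post ++ pre)
      cycle = Unique-resp-↭ (setoid (Fin d)) (↭⇒↭ₛ C↭) uC
            , (λ x x∈ → inP x (∈-resp-↭ (↭-sym C↭) x∈))
            , Closed-rotate pre v post (subst Closed C≡ closed)
      shortest' : ∀ C' → IsCycle E P C' → v ∈ C' → length (v ∷ post ++ pre) ≤ length C'
      shortest' C' cycle' v∈C' = subst (_≤ length C') (↭-length C↭) (shortest C' cycle' v∈C')

    module _ (L : Fin d → Set) (E-trans : ∀ {a b c} → L a → L b → L c → E a b → E b c → E a c) where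

      shortcut : ∀ {x z} ws → PathEdges E x ws z → ThreeInARow L (x ∷ ws ++ z ∷ []) →
        ∃ λ ws' → ws' ⊆ ws × length ws' < length ws × PathEdges E x ws' z
      shortcut [] _ (there (there ()))
      shortcut (y ∷ []) (exy , eyz) (here lx ly lz) = [] , y ∷ʳ [] , ℕP.≤-refl , E-trans lx ly lz exy eyz
      shortcut (y ∷ w ∷ ws) (exy , eyw , p) (here lx ly lw) =
        w ∷ ws , y ∷ʳ ⊆-refl , ℕP.≤-refl , E-trans lx ly lw exy eyw , p
      shortcut (y ∷ ws) (exy , p) (there run) =
        let (ws' , ws'⊆ws , shorter , p') = shortcut ws p run
        in y ∷ ws' , refl ∷ ws'⊆ws , s≤s shorter , exy , p'

      shortest-cycle-no-run : ∀ {ws} → ShortestCycleThrough E P v (v ∷ ws) →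
        ¬ ThreeInARow L (v ∷ ws ++ v ∷ [])
      shortest-cycle-no-run {ws} ((u , inP , closed) , _ , shortest) run with shortcut ws closed run
      ... | ws' , ws'⊆ws , shorter , closed' =
        ℕP.<-irrefl refl (ℕP.<-≤-trans (s≤s shorter) (shortest (v ∷ ws') cycle' (here refl)))
        where
        sub : v ∷ ws' ⊆ v ∷ ws
        sub = refl ∷ ws'⊆ws
        cycle' : IsCycle E P (v ∷ ws')
        cycle' = Unique-resp-⊇ sub u , (λ x x∈ → inP x (Any-resp-⊆ sub x∈)) , closed'

  module BackwardEdges {σ : List (Fin d)} (uσ : Unique σ) (σ-complete : ∀ x → x ∈ σ) (E-irrefl : ∀ {x} → ¬ E x x) where

    record BackwardEdge (vs : List (Fin d)) : Set where
      field
        {tail head} : Fin d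
        tail∈ : tail ∈ vs
        head∈ : head ∈ vs
        edge : E tail head
        head≺tail : Precedes σ head tail

    BackwardEdge-mono : ∀ {vs vs'} → (∀ {z} → z ∈ vs → z ∈ vs') → BackwardEdge vs → BackwardEdge vs'
    BackwardEdge-mono vs⊆vs' record { tail∈ = t∈ ; head∈ = h∈ ; edge = e ; head≺tail = h≺t } =
      record { tail∈ = vs⊆vs' t∈ ; head∈ = vs⊆vs' h∈ ; edge = e ; head≺tail = h≺t }

    edge-forward-or-backward : ∀ {a b} → E a b → Precedes σ a b ⊎ Precedes σ b a
    edge-forward-or-backward {a} {b} eab =
      Precedes-total Fin._≟_ (σ-complete a) (σ-complete b) (λ { refl → E-irrefl eab })

    path-forward-or-backward : ∀ {a b} ws → PathEdges E a ws b →
      Precedes σ a b ⊎ BackwardEdge (a ∷ ws ++ b ∷ [])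
    path-forward-or-backward [] eab with edge-forward-or-backward eab
    ... | inj₁ a≺b = inj₁ a≺b
    ... | inj₂ b≺a = inj₂ (record { tail∈ = here refl ; head∈ = there (here refl) ; edge = eab ; head≺tail = b≺a })
    path-forward-or-backward (w ∷ ws) (eaw , p) with path-forward-or-backward ws p
    ... | inj₂ backward = inj₂ (BackwardEdge-mono there backward)
    ... | inj₁ w≺b with edge-forward-or-backward eaw
    ...   | inj₁ a≺w = inj₁ (Precedes-trans uσ a≺w w≺b)
    ...   | inj₂ w≺a = inj₂ (record { tail∈ = here refl ; head∈ = there (here refl) ; edge = eaw ; head≺tail = w≺a })

    cycle-backward-edge : ∀ {v} ws → PathEdges E v ws v → BackwardEdge (v ∷ ws)
    cycle-backward-edge {v} ws closed with path-forward-or-backward ws closed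
    ... | inj₁ v≺v = ⊥-elim (Precedes-irrefl uσ v≺v)
    ... | inj₂ backward = BackwardEdge-mono ∈-closed backward
      where
      ∈-closed : ∀ {z} → z ∈ v ∷ ws ++ v ∷ [] → z ∈ v ∷ ws
      ∈-closed (here refl) = here refl
      ∈-closed (there z∈) with ∈-++⁻ ws z∈
      ... | inj₁ z∈ws = there z∈ws
      ... | inj₂ (here refl) = here refl

-- Each inequality is proved by writing the difference of its sides as a sum of nonnegative
-- terms; the ring solver checks the identity.

module ℚ-slack where

  0≤+ : ∀ {p q} → 0ℚ ℚ.≤ p → 0ℚ ℚ.≤ q → 0ℚ ℚ.≤ p ℚ.+ q
  0≤+ = ℚP.+-mono-≤

  0≤* : ∀ {p q} → 0ℚ ℚ.≤ p → 0ℚ ℚ.≤ q → 0ℚ ℚ.≤ p ℚ.* q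
  0≤* {p} {q} 0≤p 0≤q = subst (ℚ._≤ p ℚ.* q) (ℚP.*-zeroʳ p) (ℚP.*-monoˡ-≤-nonNeg p {{ℚ.nonNegative 0≤p}} 0≤q)

  0≤- : ∀ {p q} → p ℚ.≤ q → 0ℚ ℚ.≤ q ℚ.- p
  0≤- {p} {q} p≤q = subst (ℚ._≤ q ℚ.- p) (ℚP.+-inverseʳ p) (ℚP.+-monoˡ-≤ (ℚ.- p) p≤q)

  0<* : ∀ {p q} → 0ℚ ℚ.< p → 0ℚ ℚ.< q → 0ℚ ℚ.< p ℚ.* q
  0<* {p} {q} 0<p 0<q = subst (ℚ._< p ℚ.* q) (ℚP.*-zeroʳ p) (ℚP.*-monoʳ-<-pos p {{ℚ.positive 0<p}} 0<q)

  <⇒≱ : ∀ {p q} → p ℚ.< q → ¬ (q ℚ.≤ p)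
  <⇒≱ p<q q≤p = ℚP.<-irrefl refl (ℚP.<-≤-trans p<q q≤p)

  ≤-by-slack : ∀ {p q} s → 0ℚ ℚ.≤ s → q ≡ p ℚ.+ s → p ℚ.≤ q
  ≤-by-slack {p} s 0≤s refl = subst (ℚ._≤ p ℚ.+ s) (ℚP.+-identityʳ p) (ℚP.+-monoʳ-≤ p 0≤s)

  <-by-slack : ∀ {p q} s → 0ℚ ℚ.< s → q ≡ p ℚ.+ s → p ℚ.< q
  <-by-slack {p} s 0<s refl = subst (ℚ._< p ℚ.+ s) (ℚP.+-identityʳ p) (ℚP.+-monoʳ-< p 0<s)

module Arithmetic (α N : ℚ) (0≤α : 0ℚ ℚ.≤ α) (1≤N : 1ℚ ℚ.≤ N) where
  open ℚ-slack
  open QS using (solve; _:=_; _:+_; _:*_; _:-_; con)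

  threshold lazyBound : ℚ
  threshold = (1ℚ ℚ.- ℕ→ℚ 2 ℚ.* α) ℚ.* N
  lazyBound = α ℚ.* N

  0<N : 0ℚ ℚ.< N
  0<N = ℚP.<-≤-trans (ℚP.positive⁻¹ 1ℚ) 1≤N

  0≤N : 0ℚ ℚ.≤ N
  0≤N = ℚP.<⇒≤ 0<N

  0≤lazyBound : 0ℚ ℚ.≤ lazyBound
  0≤lazyBound = 0≤* 0≤α 0≤N

  lazy-pair<threshold : α ℚ.≤ + 1 / 10 → ∀ {cx cy} → cx ℚ.≤ lazyBound → cy ℚ.≤ lazyBound →
    cx ℚ.+ cy ℚ.< threshold
  lazy-pair<threshold α≤ {cx} {cy} cx≤ cy≤ = ℚP.≤-<-trans (ℚP.+-mono-≤ cx≤ cy≤) (<-by-slack _ 0<slack identity)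
    where
    0<slack : 0ℚ ℚ.< (ℕ→ℚ 4 ℚ.* (+ 1 / 10 ℚ.- α) ℚ.+ + 6 / 10) ℚ.* N
    0<slack = 0<* (ℚP.+-mono-≤-< (0≤* (ℕ→ℚ-nonNeg 4) (0≤- α≤)) (ℚP.positive⁻¹ (+ 6 / 10))) 0<N
    identity : threshold ≡ lazyBound ℚ.+ lazyBound ℚ.+ (ℕ→ℚ 4 ℚ.* (+ 1 / 10 ℚ.- α) ℚ.+ + 6 / 10) ℚ.* N
    identity = solve 2 (λ α N → (con 1ℚ :- con (ℕ→ℚ 2) :* α) :* N :=
      α :* N :+ α :* N :+ (con (ℕ→ℚ 4) :* (con (+ 1 / 10) :- α) :+ con (+ 6 / 10)) :* N) refl α N

  lazy-pair-forces-edge : ∀ {B cx cy} → N ℚ.≤ B ℚ.+ cx ℚ.+ cy → cx ℚ.≤ lazyBound → cy ℚ.≤ lazyBound →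
    threshold ℚ.≤ B
  lazy-pair-forces-edge {B} {cx} {cy} N≤ cx≤ cy≤ =
    ≤-by-slack _ (0≤+ (0≤+ (0≤- N≤) (0≤- cx≤)) (0≤- cy≤)) (identity α N B cx cy)
    where
    identity : ∀ α N B cx cy → B ≡ (1ℚ ℚ.- ℕ→ℚ 2 ℚ.* α) ℚ.* N ℚ.+
      ((B ℚ.+ cx ℚ.+ cy ℚ.- N) ℚ.+ (α ℚ.* N ℚ.- cx) ℚ.+ (α ℚ.* N ℚ.- cy))
    identity = solve 5 (λ α N B cx cy → B := (con 1ℚ :- con (ℕ→ℚ 2) :* α) :* N :+
      ((B :+ cx :+ cy :- N) :+ (α :* N :- cx) :+ (α :* N :- cy))) refl

  cost-of-backward-edge : ∀ {cx cy ax ay} → threshold ℚ.≤ cx ℚ.+ cy →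
    cx ℚ.≤ ax ℚ.+ lazyBound → cy ℚ.≤ ay ℚ.+ lazyBound → N ℚ.≤ ax ℚ.+ ay ℚ.+ ℕ→ℚ 4 ℚ.* lazyBound
  cost-of-backward-edge {cx} {cy} {ax} {ay} t≤ cx≤ cy≤ =
    ≤-by-slack _ (0≤+ (0≤+ (0≤- t≤) (0≤- cx≤)) (0≤- cy≤)) (identity α N cx cy ax ay)
    where
    identity : ∀ α N cx cy ax ay → ax ℚ.+ ay ℚ.+ ℕ→ℚ 4 ℚ.* (α ℚ.* N) ≡ N ℚ.+
      ((cx ℚ.+ cy ℚ.- (1ℚ ℚ.- ℕ→ℚ 2 ℚ.* α) ℚ.* N) ℚ.+ (ax ℚ.+ α ℚ.* N ℚ.- cx) ℚ.+ (ay ℚ.+ α ℚ.* N ℚ.- cy))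
    identity = solve 6 (λ α N cx cy ax ay → ax :+ ay :+ con (ℕ→ℚ 4) :* (α :* N) := N :+
      ((cx :+ cy :- (con 1ℚ :- con (ℕ→ℚ 2) :* α) :* N) :+ (ax :+ α :* N :- cx) :+ (ay :+ α :* N :- cy))) refl

  κ : ℚ
  κ = ℕ→ℚ 3 ℚ.+ ℕ→ℚ 4 ℚ.* α

  cycle-charge : ∀ {s k g} → s ℚ.≤ ℕ→ℚ 3 ℚ.* N ℚ.* k ℚ.+ N → N ℚ.≤ g ℚ.+ ℕ→ℚ 4 ℚ.* lazyBound → 1ℚ ℚ.≤ k →
    s ℚ.≤ κ ℚ.* N ℚ.* k ℚ.+ g
  cycle-charge {s} {k} {g} s≤ N≤ 1≤k =
    ≤-by-slack _ (0≤+ (0≤+ (0≤- s≤) (0≤- N≤)) (0≤* (0≤* (0≤* (ℕ→ℚ-nonNeg 4) 0≤α) 0≤N) (0≤- 1≤k)))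
      (identity α N s k g)
    where
    identity : ∀ α N s k g → (ℕ→ℚ 3 ℚ.+ ℕ→ℚ 4 ℚ.* α) ℚ.* N ℚ.* k ℚ.+ g ≡ s ℚ.+
      ((ℕ→ℚ 3 ℚ.* N ℚ.* k ℚ.+ N ℚ.- s) ℚ.+ (g ℚ.+ ℕ→ℚ 4 ℚ.* (α ℚ.* N) ℚ.- N)
       ℚ.+ ℕ→ℚ 4 ℚ.* α ℚ.* N ℚ.* (k ℚ.- 1ℚ))
    identity = solve 5 (λ α N s k g → (con (ℕ→ℚ 3) :+ con (ℕ→ℚ 4) :* α) :* N :* k :+ g := s :+
      ((con (ℕ→ℚ 3) :* N :* k :+ N :- s) :+ (g :+ con (ℕ→ℚ 4) :* (α :* N) :- N)
       :+ con (ℕ→ℚ 4) :* α :* N :* (k :- con 1ℚ))) refl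

  charge-+ : ∀ {s₁ s₂ k₁ k₂ g₁ g₂} → s₁ ℚ.≤ κ ℚ.* N ℚ.* k₁ ℚ.+ g₁ → s₂ ℚ.≤ κ ℚ.* N ℚ.* k₂ ℚ.+ g₂ →
    s₁ ℚ.+ s₂ ℚ.≤ κ ℚ.* N ℚ.* (k₁ ℚ.+ k₂) ℚ.+ (g₁ ℚ.+ g₂)
  charge-+ {k₁ = k₁} {k₂} {g₁} {g₂} h₁ h₂ = subst (_ ℚ.≤_) (identity α N k₁ k₂ g₁ g₂) (ℚP.+-mono-≤ h₁ h₂)
    where
    identity : ∀ α N k₁ k₂ g₁ g₂ →
      (ℕ→ℚ 3 ℚ.+ ℕ→ℚ 4 ℚ.* α) ℚ.* N ℚ.* k₁ ℚ.+ g₁ ℚ.+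
      ((ℕ→ℚ 3 ℚ.+ ℕ→ℚ 4 ℚ.* α) ℚ.* N ℚ.* k₂ ℚ.+ g₂) ≡
      (ℕ→ℚ 3 ℚ.+ ℕ→ℚ 4 ℚ.* α) ℚ.* N ℚ.* (k₁ ℚ.+ k₂) ℚ.+ (g₁ ℚ.+ g₂)
    identity = solve 6 (λ α N k₁ k₂ g₁ g₂ →
      (con (ℕ→ℚ 3) :+ con (ℕ→ℚ 4) :* α) :* N :* k₁ :+ g₁ :+
      ((con (ℕ→ℚ 3) :+ con (ℕ→ℚ 4) :* α) :* N :* k₂ :+ g₂) :=
      (con (ℕ→ℚ 3) :+ con (ℕ→ℚ 4) :* α) :* N :* (k₁ :+ k₂) :+ (g₁ :+ g₂)) refl

  final-bound : ∀ {β T O AR DA LD CD CA} → 0ℚ ℚ.≤ β → 0ℚ ℚ.≤ O → 0ℚ ℚ.≤ AR →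
    T ℚ.+ CA ℚ.≤ N ℚ.* (AR ℚ.+ DA ℚ.+ LD ℚ.+ AR) ℚ.+ O →
    N ℚ.* (LD ℚ.+ DA) ℚ.≤ κ ℚ.* N ℚ.* DA ℚ.+ CD →
    CD ℚ.≤ CA →
    (AR ℚ.+ DA) ℚ.* N ℚ.≤ β ℚ.* O →
    T ℚ.≤ (1ℚ ℚ.+ ℕ→ℚ 3 ℚ.* β ℚ.* (1ℚ ℚ.+ ℕ→ℚ 8 ℚ.* α)) ℚ.* O
  final-bound {β} {T} {O} {AR} {DA} {LD} {CD} {CA} 0≤β 0≤O 0≤AR h₁ h₂ h₃ h₄ =
    ≤-by-slack _ (0≤+ (0≤+ (0≤+ (0≤+ (0≤+ (0≤- h₁) (0≤- h₂)) (0≤- h₃))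
                                (0≤* (0≤* (0≤+ (ℕ→ℚ-nonNeg 1) (0≤* (ℕ→ℚ-nonNeg 4) 0≤α)) 0≤N) 0≤AR))
                        (0≤* (0≤+ (ℕ→ℚ-nonNeg 3) (0≤* (ℕ→ℚ-nonNeg 4) 0≤α)) (0≤- h₄)))
                 (0≤* (0≤* (0≤* (ℕ→ℚ-nonNeg 20) 0≤α) 0≤β) 0≤O))
      (identity α β N T O AR DA LD CD CA)
    where
    identity : ∀ α β N T O AR DA LD CD CA →
      (1ℚ ℚ.+ ℕ→ℚ 3 ℚ.* β ℚ.* (1ℚ ℚ.+ ℕ→ℚ 8 ℚ.* α)) ℚ.* O ≡ T ℚ.+
        ((N ℚ.* (AR ℚ.+ DA ℚ.+ LD ℚ.+ AR) ℚ.+ O ℚ.- (T ℚ.+ CA))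
         ℚ.+ ((ℕ→ℚ 3 ℚ.+ ℕ→ℚ 4 ℚ.* α) ℚ.* N ℚ.* DA ℚ.+ CD ℚ.- N ℚ.* (LD ℚ.+ DA))
         ℚ.+ (CA ℚ.- CD)
         ℚ.+ (ℕ→ℚ 1 ℚ.+ ℕ→ℚ 4 ℚ.* α) ℚ.* N ℚ.* AR
         ℚ.+ (ℕ→ℚ 3 ℚ.+ ℕ→ℚ 4 ℚ.* α) ℚ.* (β ℚ.* O ℚ.- (AR ℚ.+ DA) ℚ.* N)
         ℚ.+ ℕ→ℚ 20 ℚ.* α ℚ.* β ℚ.* O)
    identity = solve 10 (λ α β N T O AR DA LD CD CA →
      (con 1ℚ :+ con (ℕ→ℚ 3) :* β :* (con 1ℚ :+ con (ℕ→ℚ 8) :* α)) :* O := T :+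
        ((N :* (AR :+ DA :+ LD :+ AR) :+ O :- (T :+ CA))
         :+ ((con (ℕ→ℚ 3) :+ con (ℕ→ℚ 4) :* α) :* N :* DA :+ CD :- N :* (LD :+ DA))
         :+ (CA :- CD)
         :+ (con (ℕ→ℚ 1) :+ con (ℕ→ℚ 4) :* α) :* N :* AR
         :+ (con (ℕ→ℚ 3) :+ con (ℕ→ℚ 4) :* α) :* (β :* O :- (AR :+ DA) :* N)
         :+ con (ℕ→ℚ 20) :* α :* β :* O)) refl

-- The analysis of the Relative Order Algorithm

module Analysis
  {d n : ℕ} (S : Fin n → List (Fin d)) (S-ranking : ∀ i → IsRanking (S i))
  (σ* : List (Fin d)) (σ*-ranking : IsRanking σ*)
  (ℓ : Fin n → List (Fin d)) (ℓ-LCS : ∀ i → IsLCS (ℓ i) (S i) σ*)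
  (α : ℚ) (0≤α : 0ℚ ℚ.≤ α) (α≤1/10 : α ℚ.≤ + 1 / 10) (1≤n : 1 ≤ n)
  where

  open import Data.List.Membership.DecPropositional (Fin._≟_ {n = d}) using (_∈?_)

  N : ℚ
  N = ℕ→ℚ n

  open Arithmetic α N 0≤α (ℕ→ℚ-mono-≤ 1≤n)
  open Cycles (Edge S α)

  uσ* : Unique σ*
  uσ* = Unique-ranking σ*-ranking

  uS : ∀ i → Unique (S i)
  uS i = Unique-ranking (S-ranking i)

  ℓ⊆S : ∀ i → ℓ i ⊆ S i
  ℓ⊆S i = proj₁ (ℓ-LCS i)

  ℓ⊆σ* : ∀ i → ℓ i ⊆ σ*
  ℓ⊆σ* i = proj₁ (proj₂ (ℓ-LCS i))

  ℓ-order : ∀ i {x y} → x ∈ ℓ i → y ∈ ℓ i → Precedes σ* x y → Precedes (S i) x y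
  ℓ-order i x∈ y∈ x≺y with Precedes-total Fin._≟_ x∈ y∈ (Precedes⇒≢ uσ* x≺y)
  ... | inj₁ x≺y-in-ℓ = Precedes-resp-⊆ (ℓ⊆S i) (uS i) x≺y-in-ℓ
  ... | inj₂ y≺x-in-ℓ = ⊥-elim (Precedes-asym uσ* x≺y (Precedes-resp-⊆ (ℓ⊆σ* i) uσ* y≺x-in-ℓ))

  cost : Fin d → ℕ
  cost = costSym ℓ

  cost≡Σ : ∀ x → cost x ≡ Σ[ n ] (λ i → ⟦ not (x ∈ᵇ ℓ i) ⟧)
  cost≡Σ x = length-filter≡Σ _ (allFin n)

  active : Fin d → Bool
  active x = does (lazyBound ℚ.<? ℕ→ℚ (cost x))

  lazy : Fin d → Bool
  lazy x = not (active x)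

  Lazy : Fin d → Set
  Lazy x = active x ≡ false

  lazy-cost : ∀ {x} → Lazy x → ℕ→ℚ (cost x) ℚ.≤ lazyBound
  lazy-cost {x} lazy = ℚP.≮⇒≥ (does-false⇒ (lazyBound ℚ.<? ℕ→ℚ (cost x)) lazy)

  activeCost : Fin d → ℕ
  activeCost x = ⟦ active x ⟧ * cost x

  cost≤activeCost+lazyBound : ∀ x → ℕ→ℚ (cost x) ℚ.≤ ℕ→ℚ (activeCost x) ℚ.+ lazyBound
  cost≤activeCost+lazyBound x = bound (active x) (cost x) lazy-cost
    where
    bound : ∀ b c → (b ≡ false → ℕ→ℚ c ℚ.≤ lazyBound) → ℕ→ℚ c ℚ.≤ ℕ→ℚ (⟦ b ⟧ * c) ℚ.+ lazyBound
    bound true c _ = subst (λ m → ℕ→ℚ c ℚ.≤ ℕ→ℚ m ℚ.+ lazyBound) (sym (ℕP.+-identityʳ c))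
      (ℚ-slack.≤-by-slack lazyBound 0≤lazyBound refl)
    bound false c lazy = subst (ℕ→ℚ c ℚ.≤_) (sym (ℚP.+-identityˡ lazyBound)) (lazy refl)

  #precedes : Fin d → Fin d → ℕ
  #precedes a b = Σ[ n ] (λ i → ⟦ before (S i) a b ⟧)

  Edge≡threshold≤ : ∀ a b → Edge S α a b ≡ (threshold ℚ.≤ ℕ→ℚ (#precedes a b))
  Edge≡threshold≤ a b = cong (λ c → threshold ℚ.≤ ℕ→ℚ c)
    (trans (length-filter≡Σ _ (allFin n)) (Σ-cong n (λ i → ⟦≟true⟧ (before (S i) a b))))
    where
    ⟦≟true⟧ : ∀ b → ⟦ does (b Bool.≟ true) ⟧ ≡ ⟦ b ⟧
    ⟦≟true⟧ true = refl
    ⟦≟true⟧ false = refl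

  n≤#precedes+costs : ∀ {x y} → Precedes σ* x y → n ≤ #precedes x y + cost x + cost y
  n≤#precedes+costs {x} {y} x≺y = subst₂ _≤_ Σ1≡n Σ≡
    (Σ-mono n (λ i → pointwise (before (S i) x y) (x ∈ᵇ ℓ i) (y ∈ᵇ ℓ i)
      (λ x∈ y∈ → Precedes⇒before (ℓ-order i (∈ᵇ⇒∈ x∈) (∈ᵇ⇒∈ y∈) x≺y))))
    where
    pointwise : ∀ b p q → (p ≡ true → q ≡ true → b ≡ true) → 1 ≤ ⟦ b ⟧ + ⟦ not p ⟧ + ⟦ not q ⟧
    pointwise true  _     _     _ = s≤s z≤n
    pointwise false false _     _ = s≤s z≤n
    pointwise false true  false _ = s≤s z≤n
    pointwise false true  true  h with () ← h refl refl
    Σ1≡n : Σ[ n ] (const 1) ≡ n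
    Σ1≡n = trans (Σ-const n 1) (ℕP.*-identityʳ n)
    Σ≡ : Σ[ n ] (λ i → ⟦ before (S i) x y ⟧ + ⟦ not (x ∈ᵇ ℓ i) ⟧ + ⟦ not (y ∈ᵇ ℓ i) ⟧)
       ≡ #precedes x y + cost x + cost y
    Σ≡ = trans (Σ-distrib-+ n _ _)
      (cong₂ _+_ (trans (Σ-distrib-+ n _ _) (cong (λ c → #precedes x y + c) (sym (cost≡Σ x)))) (sym (cost≡Σ y)))

  #precedes-backward≤costs : ∀ {x y} → Precedes σ* x y → #precedes y x ≤ cost x + cost y
  #precedes-backward≤costs {x} {y} x≺y = subst (#precedes y x ≤_) Σ≡
    (Σ-mono n (λ i → pointwise (before (S i) y x) (x ∈ᵇ ℓ i) (y ∈ᵇ ℓ i)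
      (λ x∈ y∈ y≺x → Precedes-asym (uS i) (ℓ-order i (∈ᵇ⇒∈ x∈) (∈ᵇ⇒∈ y∈) x≺y)
                                   (before⇒Precedes (S i) y≺x))))
    where
    pointwise : ∀ b p q → (p ≡ true → q ≡ true → b ≡ true → ⊥) → ⟦ b ⟧ ≤ ⟦ not p ⟧ + ⟦ not q ⟧
    pointwise false _     _     _ = z≤n
    pointwise true  false _     _ = s≤s z≤n
    pointwise true  true  false _ = s≤s z≤n
    pointwise true  true  true  h = ⊥-elim (h refl refl refl)
    Σ≡ : Σ[ n ] (λ i → ⟦ not (x ∈ᵇ ℓ i) ⟧ + ⟦ not (y ∈ᵇ ℓ i) ⟧) ≡ cost x + cost y
    Σ≡ = trans (Σ-distrib-+ n _ _) (sym (cong₂ _+_ (cost≡Σ x) (cost≡Σ y)))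

  #precedes-refl : ∀ x → #precedes x x ≡ 0
  #precedes-refl x = trans (Σ-cong n (λ i → never (before (S i) x x)
    (λ x≺x → Precedes-irrefl (uS i) (before⇒Precedes (S i) x≺x)))) (trans (Σ-const n 0) (ℕP.*-zeroʳ n))
    where
    never : ∀ b → (b ≡ true → ⊥) → ⟦ b ⟧ ≡ 0
    never false _ = refl
    never true h = ⊥-elim (h refl)

  Edge⇒threshold≤ : ∀ {a b} → Edge S α a b → threshold ℚ.≤ ℕ→ℚ (#precedes a b)
  Edge⇒threshold≤ {a} {b} = subst (λ A → A) (Edge≡threshold≤ a b)

  threshold≤⇒Edge : ∀ {a b} → threshold ℚ.≤ ℕ→ℚ (#precedes a b) → Edge S α a b
  threshold≤⇒Edge {a} {b} = subst (λ A → A) (sym (Edge≡threshold≤ a b))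

  edge-irrefl : ∀ {x} → ¬ Edge S α x x
  edge-irrefl {x} e = ℚ-slack.<⇒≱ (lazy-pair<threshold α≤1/10 0≤lazyBound 0≤lazyBound)
    (subst (λ c → threshold ℚ.≤ ℕ→ℚ c) (#precedes-refl x) (Edge⇒threshold≤ e))

  lazy-edge : ∀ {x y} → Lazy x → Lazy y → Precedes σ* x y → Edge S α x y
  lazy-edge {x} {y} lx ly x≺y = threshold≤⇒Edge (lazy-pair-forces-edge
    (subst (N ℚ.≤_) (ℕ→ℚ-+₃ (#precedes x y) (cost x) (cost y)) (ℕ→ℚ-mono-≤ (n≤#precedes+costs x≺y)))
    (lazy-cost lx) (lazy-cost ly))

  backward-edge-cost : ∀ {x y} → Precedes σ* x y → Edge S α y x → threshold ℚ.≤ ℕ→ℚ (cost x) ℚ.+ ℕ→ℚ (cost y)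
  backward-edge-cost {x} {y} x≺y e = ℚP.≤-trans (Edge⇒threshold≤ e)
    (subst (ℕ→ℚ (#precedes y x) ℚ.≤_) (ℕ→ℚ-+ (cost x) (cost y)) (ℕ→ℚ-mono-≤ (#precedes-backward≤costs x≺y)))

  open BackwardEdges uσ* (∈-ranking σ*-ranking) edge-irrefl

  lazy-edge-forward : ∀ {x y} → Lazy x → Lazy y → Edge S α x y → Precedes σ* x y
  lazy-edge-forward {x} {y} lx ly e =
    [ (λ x≺y → x≺y)
    , (λ y≺x → ⊥-elim (ℚ-slack.<⇒≱ (lazy-pair<threshold α≤1/10 (lazy-cost ly) (lazy-cost lx)) (backward-edge-cost y≺x e)))
    ]′ (edge-forward-or-backward e)

  lazy-edge-trans : ∀ {a b c} → Lazy a → Lazy b → Lazy c → Edge S α a b → Edge S α b c → Edge S α a c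
  lazy-edge-trans la lb lc eab ebc =
    lazy-edge la lc (Precedes-trans uσ* (lazy-edge-forward la lb eab) (lazy-edge-forward lb lc ebc))

  size #active activeCostIn : (Fin d → Bool) → ℕ
  size Q = Σ⟨ Q ⟩ const 1
  #active Q = Σ⟨ Q ⟩ (λ x → ⟦ active x ⟧)
  activeCostIn Q = Σ⟨ Q ⟩ activeCost

  ChargeableBy : ℕ → ℕ → ℕ → Set
  ChargeableBy s k g = N ℚ.* ℕ→ℚ s ℚ.≤ κ ℚ.* N ℚ.* ℕ→ℚ k ℚ.+ ℕ→ℚ g

  Chargeable : (Fin d → Bool) → Set
  Chargeable Q = ChargeableBy (size Q) (#active Q) (activeCostIn Q)

  ChargeableBy-cong : ∀ {s k g} s' k' g' → s ≡ s' → k ≡ k' → g ≡ g' → ChargeableBy s k g → ChargeableBy s' k' g'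
  ChargeableBy-cong _ _ _ refl refl refl charge = charge

  Chargeable-cong : ∀ {Q Q'} → (∀ x → Q x ≡ Q' x) → Chargeable Q → Chargeable Q'
  Chargeable-cong {Q' = Q'} Q≗Q' =
    ChargeableBy-cong (size Q') (#active Q') (activeCostIn Q') (Σ⟨⟩-cong Q≗Q') (Σ⟨⟩-cong Q≗Q') (Σ⟨⟩-cong Q≗Q')

  Chargeable-∅ : Chargeable (const false)
  Chargeable-∅ = ChargeableBy-cong (size (const false)) (#active (const false)) (activeCostIn (const false))
    (sym (Σ⟨false⟩ {d} (const 1))) (sym (Σ⟨false⟩ {d} (λ x → ⟦ active x ⟧))) (sym (Σ⟨false⟩ {d} activeCost))
    charge₀
    where
    charge₀ : ChargeableBy 0 0 0
    charge₀ = subst₂ ℚ._≤_ (sym (ℚP.*-zeroʳ N))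
      (sym (trans (ℚP.+-identityʳ (κ ℚ.* N ℚ.* 0ℚ)) (ℚP.*-zeroʳ (κ ℚ.* N)))) ℚP.≤-refl

  Chargeable-∨ : ∀ {Q Q'} → (∀ x → Q x ∧ Q' x ≡ false) → Chargeable Q → Chargeable Q' →
    Chargeable (λ x → Q x ∨ Q' x)
  Chargeable-∨ {Q} {Q'} disjoint charge charge' =
    ChargeableBy-cong (size Q∨Q') (#active Q∨Q') (activeCostIn Q∨Q')
      (sym (Σ⟨⟩-∨ Q Q' (const 1) disjoint)) (sym (Σ⟨⟩-∨ Q Q' (λ x → ⟦ active x ⟧) disjoint))
      (sym (Σ⟨⟩-∨ Q Q' activeCost disjoint))
      (subst₂ ℚ._≤_ (sym lhs) (sym rhs) (charge-+ charge charge'))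
    where
    Q∨Q' : Fin d → Bool
    Q∨Q' x = Q x ∨ Q' x
    lhs : N ℚ.* ℕ→ℚ (size Q + size Q') ≡ N ℚ.* ℕ→ℚ (size Q) ℚ.+ N ℚ.* ℕ→ℚ (size Q')
    lhs = trans (cong (N ℚ.*_) (ℕ→ℚ-+ (size Q) (size Q'))) (ℚP.*-distribˡ-+ N _ _)
    rhs : κ ℚ.* N ℚ.* ℕ→ℚ (#active Q + #active Q') ℚ.+ ℕ→ℚ (activeCostIn Q + activeCostIn Q')
        ≡ κ ℚ.* N ℚ.* (ℕ→ℚ (#active Q) ℚ.+ ℕ→ℚ (#active Q'))
          ℚ.+ (ℕ→ℚ (activeCostIn Q) ℚ.+ ℕ→ℚ (activeCostIn Q'))
    rhs = cong₂ ℚ._+_ (cong (κ ℚ.* N ℚ.*_) (ℕ→ℚ-+ (#active Q) (#active Q'))) (ℕ→ℚ-+ (activeCostIn Q) (activeCostIn Q'))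

  module _ {K : List (Fin d)} (backward : BackwardEdge K) where
    open BackwardEdge backward

    head≢tail : head ≢ tail
    head≢tail = Precedes⇒≢ uσ* head≺tail

    backward-edge-has-active : 1 ≤ #true active K
    backward-edge-has-active = ℕP.≤-trans
      (1≤⟦⟧+⟦⟧ (active head) (active tail) (λ lh lt → Precedes-asym uσ* head≺tail (lazy-edge-forward lt lh edge)))
      (∈²⇒≤sum (λ x → ⟦ active x ⟧) head∈ tail∈ head≢tail)

    backward-edge-pays : N ℚ.≤ ℕ→ℚ (sum (map activeCost K)) ℚ.+ ℕ→ℚ 4 ℚ.* lazyBound
    backward-edge-pays = ℚP.≤-trans N≤ac+ac+4αN
      (ℚP.+-monoˡ-≤ (ℕ→ℚ 4 ℚ.* lazyBound)
        (subst (ℚ._≤ ℕ→ℚ (sum (map activeCost K))) (ℕ→ℚ-+ (activeCost head) (activeCost tail))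
          (ℕ→ℚ-mono-≤ (∈²⇒≤sum activeCost head∈ tail∈ head≢tail))))
      where
      N≤ac+ac+4αN : N ℚ.≤ ℕ→ℚ (activeCost head) ℚ.+ ℕ→ℚ (activeCost tail) ℚ.+ ℕ→ℚ 4 ℚ.* lazyBound
      N≤ac+ac+4αN = cost-of-backward-edge
        {ℕ→ℚ (cost head)} {ℕ→ℚ (cost tail)} {ℕ→ℚ (activeCost head)} {ℕ→ℚ (activeCost tail)}
        (backward-edge-cost head≺tail edge) (cost≤activeCost+lazyBound head) (cost≤activeCost+lazyBound tail)

  shortest-cycle-chargeable : ∀ {P v C} → ShortestCycleThrough (Edge S α) P v C → Chargeable (_∈ᵇ C)
  shortest-cycle-chargeable {P} {v} {C} sc = charge (rotate-shortest sc)
    where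
    charge : (∃ λ ws → ShortestCycleThrough (Edge S α) P v (v ∷ ws) × C ↭ v ∷ ws) → Chargeable (_∈ᵇ C)
    charge (ws , sc'@((uK , _ , closed) , _) , C↭K) =
      ChargeableBy-cong (size (_∈ᵇ C)) (#active (_∈ᵇ C)) (activeCostIn (_∈ᵇ C))
        (sym (Σ⟨∈ᵇ⟩-↭ C↭K uK (const 1))) (sym (Σ⟨∈ᵇ⟩-↭ C↭K uK (λ x → ⟦ active x ⟧)))
        (sym (Σ⟨∈ᵇ⟩-↭ C↭K uK activeCost))
        (cycle-charge {N ℚ.* ℕ→ℚ (sum (map (const 1) K))} {ℕ→ℚ k} {ℕ→ℚ g}
          N*size≤ N≤g+4αN (ℕ→ℚ-mono-≤ 1≤k))
      where
      K : List (Fin d)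
      K = v ∷ ws
      k m g : ℕ
      k = #true active K
      m = #false active K
      g = sum (map activeCost K)
      m≤2k+1 : m ≤ 2 * k + 1
      m≤2k+1 = #false≤2*#true+1-cyclic active v ws (shortest-cycle-no-run Lazy lazy-edge-trans sc')
      n*size≤ : n * sum (map (const 1) K) ≤ 3 * n * k + n
      n*size≤ = ℕP.≤-trans (ℕP.*-monoʳ-≤ n (ℕP.≤-trans (ℕP.≤-reflexive (sym (#true+#false active K)))
                  (ℕP.+-monoʳ-≤ k m≤2k+1))) (ℕP.≤-reflexive (arith n k))
        where
        arith : ∀ n k → n * (k + (2 * k + 1)) ≡ 3 * n * k + n
        arith = solve-∀
      N*size≤ : N ℚ.* ℕ→ℚ (sum (map (const 1) K)) ℚ.≤ ℕ→ℚ 3 ℚ.* N ℚ.* ℕ→ℚ k ℚ.+ N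
      N*size≤ = subst₂ ℚ._≤_ (ℕ→ℚ-* n _)
        (trans (ℕ→ℚ-+ (3 * n * k) n) (cong (ℚ._+ N) (trans (ℕ→ℚ-* (3 * n) k) (cong (ℚ._* ℕ→ℚ k) (ℕ→ℚ-* 3 n)))))
        (ℕ→ℚ-mono-≤ n*size≤)
      1≤k : 1 ≤ k
      1≤k = backward-edge-has-active (cycle-backward-edge ws closed)
      N≤g+4αN : N ℚ.≤ ℕ→ℚ g ℚ.+ ℕ→ℚ 4 ℚ.* lazyBound
      N≤g+4αN = backward-edge-pays (cycle-backward-edge ws closed)

  step-chargeable : ∀ {v P P'} → Step (Edge S α) v P P' → Chargeable (not ∘ P) → Chargeable (not ∘ P')
  step-chargeable {P = P} {P'} (inj₁ (_ , P'≗P)) =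
    Chargeable-cong {not ∘ P} {not ∘ P'} (λ x → cong not (sym (P'≗P x)))
  step-chargeable {v} {P} {P'} (inj₂ (C , sc@(cycle , _) , P'≗)) charge =
    Chargeable-cong {λ x → not (P x) ∨ x ∈ᵇ C} {not ∘ P'}
      (λ x → sym (trans (cong not (P'≗ x)) (not-∧-not (P x) (x ∈ᵇ C))))
      (Chargeable-∨ {not ∘ P} {_∈ᵇ C}
        (λ x → not-∧-disjoint (P x) (x ∈ᵇ C) (λ x∈C → IsCycle⇒present cycle (∈ᵇ⇒∈ x∈C)))
        charge (shortest-cycle-chargeable {P} {v} {C} sc))

  deleted-chargeable : ∀ {run} → IsRun (Edge S α) run → ∀ j → Chargeable (not ∘ run j)
  deleted-chargeable {run} (all-present , steps) = <-weakInduction (λ j → Chargeable (not ∘ run j))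
    (Chargeable-cong (λ x → sym (cong not (all-present x))) Chargeable-∅)
    (λ v → step-chargeable (steps v))

  lazyMissing : Fin n → ℕ
  lazyMissing i = Σ⟨ lazy ⟩ (λ x → ⟦ not (x ∈ᵇ ℓ i) ⟧)

  #allActive : ℕ
  #allActive = Σ[ d ] (λ x → ⟦ active x ⟧)

  allActiveCost : ℕ
  allActiveCost = Σ[ d ] activeCost

  |ℓ|≡lcsLen : ∀ i → length (ℓ i) ≡ lcsLen (S i) σ*
  |ℓ|≡lcsLen i = ℕP.≤-antisym (lcsLen-≥ (ℓ⊆S i) (ℓ⊆σ* i)) lcsLen≤|ℓ|
    where
    lcsLen≤|ℓ| : lcsLen (S i) σ* ≤ length (ℓ i)
    lcsLen≤|ℓ| = let (l , l⊆S , l⊆σ* , lcs≡) = lcsLen-witness (S i) σ*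
                 in subst (_≤ length (ℓ i)) (sym lcs≡) (proj₂ (proj₂ (ℓ-LCS i)) l l⊆S l⊆σ*)

  ulam-σ*≡ : ∀ i → ulam (S i) σ* ≡ Σ⟨ (λ x → not (x ∈ᵇ ℓ i)) ⟩ const 1
  ulam-σ*≡ i = begin
    d ∸ lcsLen (S i) σ*                   ≡⟨ cong (d ∸_) (sym (|ℓ|≡lcsLen i)) ⟩
    d ∸ length (ℓ i)                      ≡⟨ cong₂ _∸_ d≡ |ℓ|≡ ⟩
    Σ⟨ ∈ℓ ⟩ const 1 + Σ⟨ not ∘ ∈ℓ ⟩ const 1 ∸ Σ⟨ ∈ℓ ⟩ const 1 ≡⟨ ℕP.m+n∸m≡n (Σ⟨ ∈ℓ ⟩ const 1) _ ⟩
    Σ⟨ not ∘ ∈ℓ ⟩ const 1                 ∎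
    where
    open ≡-Reasoning
    ∈ℓ : Fin d → Bool
    ∈ℓ x = x ∈ᵇ ℓ i
    d≡ : d ≡ Σ⟨ ∈ℓ ⟩ const 1 + Σ⟨ not ∘ ∈ℓ ⟩ const 1
    d≡ = trans (sym (trans (Σ-const d 1) (ℕP.*-identityʳ d))) (Σ⟨⟩-split ∈ℓ (const 1))
    |ℓ|≡ : length (ℓ i) ≡ Σ⟨ ∈ℓ ⟩ const 1
    |ℓ|≡ = trans (sym (sum-map-const1 (ℓ i))) (sym (Σ⟨∈ᵇ⟩ (Unique-resp-⊇ (ℓ⊆σ* i) uσ*) (const 1)))

  OPT≡ : totalUlam S σ* ≡ Σ[ n ] lazyMissing + allActiveCost
  OPT≡ = begin
    Σ[ n ] (λ i → ulam (S i) σ*)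
      ≡⟨ Σ-cong n (λ i → trans (ulam-σ*≡ i) (trans (Σ-cong d (λ x → split (active x) (x ∈ᵇ ℓ i))) (Σ-distrib-+ d _ _))) ⟩
    Σ[ n ] (λ i → lazyMissing i + Σ[ d ] (λ x → ⟦ active x ⟧ * ⟦ not (x ∈ᵇ ℓ i) ⟧))
      ≡⟨ Σ-distrib-+ n _ _ ⟩
    Σ[ n ] lazyMissing + Σ[ n ] (λ i → Σ[ d ] (λ x → ⟦ active x ⟧ * ⟦ not (x ∈ᵇ ℓ i) ⟧))
      ≡⟨ cong (λ c → Σ[ n ] lazyMissing + c) (Σ-comm n d _) ⟩
    Σ[ n ] lazyMissing + Σ[ d ] (λ x → Σ[ n ] (λ i → ⟦ active x ⟧ * ⟦ not (x ∈ᵇ ℓ i) ⟧))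
      ≡⟨ cong (λ c → Σ[ n ] lazyMissing + c)
           (Σ-cong d (λ x → trans (sym (*-distribˡ-Σ n ⟦ active x ⟧ _)) (cong (⟦ active x ⟧ *_) (sym (cost≡Σ x))))) ⟩
    Σ[ n ] lazyMissing + allActiveCost ∎
    where
    open ≡-Reasoning
    split : ∀ a m → ⟦ not m ⟧ * 1 ≡ ⟦ not a ⟧ * ⟦ not m ⟧ + ⟦ a ⟧ * ⟦ not m ⟧
    split false false = refl
    split false true = refl
    split true false = refl
    split true true = refl

  module Survivors (R : Fin d → Bool) where

    activePresent activeDeleted lazyDeleted activeCostDeleted : ℕ
    activePresent = Σ⟨ R ⟩ (λ x → ⟦ active x ⟧)
    activeDeleted = #active (not ∘ R)
    lazyDeleted = Σ⟨ not ∘ R ⟩ (λ x → ⟦ lazy x ⟧)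
    activeCostDeleted = activeCostIn (not ∘ R)

    #allActive≡ : #allActive ≡ activePresent + activeDeleted
    #allActive≡ = Σ⟨⟩-split R (λ x → ⟦ active x ⟧)

    activeCostDeleted≤ : activeCostDeleted ≤ allActiveCost
    activeCostDeleted≤ = ℕP.≤-trans (ℕP.m≤n+m activeCostDeleted _) (ℕP.≤-reflexive (sym (Σ⟨⟩-split R activeCost)))

    size-deleted≡ : size (not ∘ R) ≡ lazyDeleted + activeDeleted
    size-deleted≡ = trans (Σ-cong d (λ x → split (not (R x)) (active x))) (Σ-distrib-+ d _ _)
      where
      split : ∀ q a → ⟦ q ⟧ * 1 ≡ ⟦ q ⟧ * ⟦ not a ⟧ + ⟦ q ⟧ * ⟦ a ⟧
      split false _ = refl
      split true false = refl
      split true true = refl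

  module Output {R : Fin d → Bool} {σpar : List (Fin d)} (topo : IsTopOrder (Edge S α) R σpar)
    {σ̄ : List (Fin d)} (σ̄-ranking : IsRanking σ̄) (σ̄-beats-σ* : lcsLen σ* σpar ≤ lcsLen σ̄ σpar)
    {X : List (Fin d)} (X⊆σ̄ : X ⊆ σ̄) (X⊆σpar : X ⊆ σpar) (lcsLen≤|X| : lcsLen σ̄ σpar ≤ length X) where

    open Survivors R

    uσpar : Unique σpar
    uσpar = proj₁ topo

    ∈σpar⇒R : ∀ {x} → x ∈ σpar → R x ≡ true
    ∈σpar⇒R {x} = Equivalence.to (proj₁ (proj₂ topo) x)

    R⇒∈σpar : ∀ {x} → R x ≡ true → x ∈ σpar
    R⇒∈σpar {x} = Equivalence.from (proj₁ (proj₂ topo) x)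

    topo-order : ∀ {a b} → R a ≡ true → R b ≡ true → Edge S α a b → Precedes σpar a b
    topo-order {a} {b} ra rb e = before⇒Precedes σpar (proj₂ (proj₂ topo) a b ra rb e)

    uX : Unique X
    uX = Unique-resp-⊇ X⊆σ̄ (Unique-ranking σ̄-ranking)

    Z : Fin n → List (Fin d)
    Z i = filter (λ x → T? (lazy x ∧ x ∈ᵇ ℓ i)) X

    Z⊆X : ∀ i → Z i ⊆ X
    Z⊆X i = filter-⊆ _ X

    Z⊆ℓ : ∀ i → Z i ⊆ ℓ i
    Z⊆ℓ i = ⊆-from-Precedes Fin._≟_ (Unique-resp-⊇ (Z⊆X i) uX) (Unique-resp-⊇ (ℓ⊆σ* i) uσ*)
      (λ z∈ → proj₂ (in-Z z∈)) order
      where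
      in-Z : ∀ {z} → z ∈ Z i → Lazy z × z ∈ ℓ i
      in-Z z∈ = let (lz , z∈ℓ) = T-∧⁻ (proj₂ (∈-filter⁻ (λ x → T? (lazy x ∧ x ∈ᵇ ℓ i)) {xs = X} z∈))
                in T-not⁻ (Equivalence.from T-≡ lz) , ∈ᵇ⇒∈ z∈ℓ
      order : ∀ {a b} → Precedes (Z i) a b → Precedes (ℓ i) a b
      order {a} {b} a≺b =
        [ (λ a≺b-in-ℓ → a≺b-in-ℓ)
        , (λ b≺a-in-ℓ → ⊥-elim (Precedes-asym uσpar (Precedes-resp-⊆ (⊆-trans (Z⊆X i) X⊆σpar) uσpar a≺b)
            (topo-order (R-of b∈) (R-of a∈) (lazy-edge (proj₁ (in-Z b∈)) (proj₁ (in-Z a∈))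
              (Precedes-resp-⊆ (ℓ⊆σ* i) uσ* b≺a-in-ℓ)))))
        ]′ (Precedes-total Fin._≟_ (proj₂ (in-Z a∈)) (proj₂ (in-Z b∈)) (Precedes⇒≢ (Unique-resp-⊇ (Z⊆X i) uX) a≺b))
        where
        a∈ = proj₁ (Precedes⇒∈ a≺b)
        b∈ = proj₂ (Precedes⇒∈ a≺b)
        R-of : ∀ {z} → z ∈ Z i → R z ≡ true
        R-of z∈ = ∈σpar⇒R (Any-resp-⊆ (⊆-trans (Z⊆X i) X⊆σpar) z∈)

    #Z : Fin n → ℕ
    #Z i = Σ⟨ (_∈ᵇ X) ⟩ (λ x → ⟦ lazy x ∧ x ∈ᵇ ℓ i ⟧)

    #Z≤lcsLen : ∀ i → #Z i ≤ lcsLen (S i) σ̄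
    #Z≤lcsLen i = subst (_≤ lcsLen (S i) σ̄)
      (trans (length-filter≡Σ (λ x → T? (lazy x ∧ x ∈ᵇ ℓ i)) X) (sym (Σ⟨∈ᵇ⟩ uX (λ x → ⟦ lazy x ∧ x ∈ᵇ ℓ i ⟧))))
      (lcsLen-≥ (⊆-trans (Z⊆ℓ i) (ℓ⊆S i)) (⊆-trans (Z⊆X i) X⊆σ̄))

    W : List (Fin d)
    W = filter (λ x → T? (lazy x ∧ R x)) σ*

    W⊆σpar : W ⊆ σpar
    W⊆σpar = ⊆-from-Precedes Fin._≟_ (Unique-resp-⊇ (filter-⊆ _ σ*) uσ*) uσpar
      (λ w∈ → R⇒∈σpar (proj₂ (in-W w∈))) order
      where
      in-W : ∀ {w} → w ∈ W → Lazy w × R w ≡ true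
      in-W w∈ = let (lw , rw) = T-∧⁻ (proj₂ (∈-filter⁻ (λ x → T? (lazy x ∧ R x)) {xs = σ*} w∈))
                in T-not⁻ (Equivalence.from T-≡ lw) , rw
      order : ∀ {a b} → Precedes W a b → Precedes σpar a b
      order a≺b = let (a∈ , b∈) = Precedes⇒∈ a≺b in
        topo-order (proj₂ (in-W a∈)) (proj₂ (in-W b∈))
          (lazy-edge (proj₁ (in-W a∈)) (proj₁ (in-W b∈)) (Precedes-resp-⊆ (filter-⊆ _ σ*) uσ* a≺b))

    lazyPresent≤|X| : Σ[ d ] (λ x → ⟦ lazy x ∧ R x ⟧) ≤ length X
    lazyPresent≤|X| = begin
      Σ[ d ] (λ x → ⟦ lazy x ∧ R x ⟧)
        ≡⟨ sym (Σ⟨true⟩ _ (λ x → ∈⇒∈ᵇ (∈-ranking σ*-ranking x))) ⟩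
      Σ⟨ (_∈ᵇ σ*) ⟩ (λ x → ⟦ lazy x ∧ R x ⟧)
        ≡⟨ trans (Σ⟨∈ᵇ⟩ uσ* _) (sym (length-filter≡Σ (λ x → T? (lazy x ∧ R x)) σ*)) ⟩
      length W                  ≤⟨ lcsLen-≥ (filter-⊆ _ σ*) W⊆σpar ⟩
      lcsLen σ* σpar            ≤⟨ σ̄-beats-σ* ⟩
      lcsLen σ̄ σpar             ≤⟨ lcsLen≤|X| ⟩
      length X                  ∎
      where open ℕP.≤-Reasoning

    lazyOutsideX : ℕ
    lazyOutsideX = Σ⟨ lazy ⟩ (λ x → ⟦ not (x ∈ᵇ X) ⟧)

    lazyOutsideX≤ : lazyOutsideX ≤ lazyDeleted + activePresent
    lazyOutsideX≤ = ℕP.+-cancelʳ-≤ (length X) lazyOutsideX (lazyDeleted + activePresent)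
      (ℕP.≤-trans (subst₂ _≤_ lhs rhs (Σ-mono d (λ x → pointwise (active x) (x ∈ᵇ X) (R x)
                    (λ x∈X → ∈σpar⇒R (Any-resp-⊆ X⊆σpar (∈ᵇ⇒∈ x∈X))))))
                  (ℕP.+-monoʳ-≤ (lazyDeleted + activePresent) lazyPresent≤|X|))
      where
      pointwise : ∀ a ix r → (ix ≡ true → r ≡ true) →
        ⟦ not a ⟧ * ⟦ not ix ⟧ + ⟦ ix ⟧ * 1 ≤ ⟦ not r ⟧ * ⟦ not a ⟧ + ⟦ r ⟧ * ⟦ a ⟧ + ⟦ not a ∧ r ⟧
      pointwise false false false _ = ℕP.≤-refl
      pointwise false false true  _ = ℕP.≤-refl
      pointwise false true  false _ = ℕP.≤-refl
      pointwise false true  true  _ = ℕP.≤-refl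
      pointwise true  false _     _ = z≤n
      pointwise true  true  false ix⇒r with () ← ix⇒r refl
      pointwise true  true  true  _ = ℕP.≤-refl
      |X|≡ : Σ⟨ (_∈ᵇ X) ⟩ const 1 ≡ length X
      |X|≡ = trans (Σ⟨∈ᵇ⟩ uX (const 1)) (sum-map-const1 X)
      lhs : Σ[ d ] (λ x → ⟦ not (active x) ⟧ * ⟦ not (x ∈ᵇ X) ⟧ + ⟦ x ∈ᵇ X ⟧ * 1) ≡ lazyOutsideX + length X
      lhs = trans (Σ-distrib-+ d _ _) (cong (λ c → lazyOutsideX + c) |X|≡)
      rhs : Σ[ d ] (λ x → ⟦ not (R x) ⟧ * ⟦ lazy x ⟧ + ⟦ R x ⟧ * ⟦ active x ⟧ + ⟦ lazy x ∧ R x ⟧)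
          ≡ lazyDeleted + activePresent + Σ[ d ] (λ x → ⟦ lazy x ∧ R x ⟧)
      rhs = trans (Σ-distrib-+ d _ _) (cong (_+ Σ[ d ] (λ x → ⟦ lazy x ∧ R x ⟧)) (Σ-distrib-+ d _ _))

    ulam-σ̄≤ : ∀ i → ulam (S i) σ̄ ≤ #allActive + lazyOutsideX + lazyMissing i
    ulam-σ̄≤ i = ℕP.≤-trans (ℕP.∸-monoʳ-≤ d (#Z≤lcsLen i)) (ℕP.m≤n+o⇒m∸n≤o d (#Z i) d≤)
      where
      pointwise : ∀ a ix il → 1 ≤ ⟦ ix ⟧ * ⟦ not a ∧ il ⟧ + (⟦ a ⟧ + ⟦ not a ⟧ * ⟦ not ix ⟧ + ⟦ not a ⟧ * ⟦ not il ⟧)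
      pointwise true  false _     = s≤s z≤n
      pointwise true  true  _     = s≤s z≤n
      pointwise false false _     = s≤s z≤n
      pointwise false true  false = s≤s z≤n
      pointwise false true  true  = s≤s z≤n
      d≤ : d ≤ #Z i + (#allActive + lazyOutsideX + lazyMissing i)
      d≤ = subst₂ _≤_ (trans (Σ-const d 1) (ℕP.*-identityʳ d))
        (trans (Σ-distrib-+ d _ _) (cong (λ c → #Z i + c)
          (trans (Σ-distrib-+ d _ _) (cong (_+ lazyMissing i) (Σ-distrib-+ d _ _)))))
        (Σ-mono d (λ x → pointwise (active x) (x ∈ᵇ X) (x ∈ᵇ ℓ i)))

    totalUlam-σ̄ : totalUlam S σ̄ + allActiveCost ≤ n * (#allActive + lazyDeleted + activePresent) + totalUlam S σ*
    totalUlam-σ̄ = begin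
      totalUlam S σ̄ + allActiveCost
        ≤⟨ ℕP.+-monoˡ-≤ allActiveCost (Σ-mono n (λ i → ℕP.≤-trans (ulam-σ̄≤ i)
             (ℕP.+-monoˡ-≤ (lazyMissing i) (ℕP.≤-trans (ℕP.+-monoʳ-≤ #allActive lazyOutsideX≤)
               (ℕP.≤-reflexive (sym (ℕP.+-assoc #allActive lazyDeleted activePresent))))))) ⟩
      Σ[ n ] (λ i → A + lazyMissing i) + allActiveCost
        ≡⟨ cong (_+ allActiveCost) (trans (Σ-distrib-+ n _ _) (cong (_+ Σ[ n ] lazyMissing) (Σ-const n A))) ⟩
      n * A + Σ[ n ] lazyMissing + allActiveCost
        ≡⟨ trans (ℕP.+-assoc (n * A) _ _) (cong (λ c → n * A + c) (sym OPT≡)) ⟩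
      n * A + totalUlam S σ* ∎
      where
      open ℕP.≤-Reasoning
      A : ℕ
      A = #allActive + lazyDeleted + activePresent

  relative-order-bound : ∀ {run σpar σ̄} → IsRun (Edge S α) run → IsTopOrder (Edge S α) (run (fromℕ d)) σpar →
    IsRanking σ̄ → lcsLen σ* σpar ≤ lcsLen σ̄ σpar →
    ∀ β → 0ℚ ℚ.≤ β → ℕ→ℚ (length (activeSet α ℓ)) ℚ.* N ℚ.≤ β ℚ.* ℕ→ℚ (totalUlam S σ*) →
    ℕ→ℚ (totalUlam S σ̄) ℚ.≤ (1ℚ ℚ.+ ℕ→ℚ 3 ℚ.* β ℚ.* (1ℚ ℚ.+ ℕ→ℚ 8 ℚ.* α)) ℚ.* ℕ→ℚ (totalUlam S σ*)
  relative-order-bound {run} {σpar} {σ̄} is-run topo σ̄-ranking σ̄-beats-σ* β 0≤β |A|*N≤β*OPT =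
    bound (lcsLen-witness σ̄ σpar)
    where
    open Survivors (run (fromℕ d))
    AR DA LD OPT : ℕ
    AR = activePresent
    DA = activeDeleted
    LD = lazyDeleted
    OPT = totalUlam S σ*
    bound : (∃ λ X → X ⊆ σ̄ × X ⊆ σpar × lcsLen σ̄ σpar ≡ length X) →
      ℕ→ℚ (totalUlam S σ̄) ℚ.≤ (1ℚ ℚ.+ ℕ→ℚ 3 ℚ.* β ℚ.* (1ℚ ℚ.+ ℕ→ℚ 8 ℚ.* α)) ℚ.* ℕ→ℚ OPT
    bound (X , X⊆σ̄ , X⊆σpar , lcs≡|X|) = final-bound
      {β} {ℕ→ℚ (totalUlam S σ̄)} {ℕ→ℚ OPT} {ℕ→ℚ AR} {ℕ→ℚ DA} {ℕ→ℚ LD}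
      {ℕ→ℚ activeCostDeleted} {ℕ→ℚ allActiveCost}
      0≤β (ℕ→ℚ-nonNeg OPT) (ℕ→ℚ-nonNeg AR) output deleted (ℕ→ℚ-mono-≤ activeCostDeleted≤) |A|*N≤β*OPT'
      where
      open Output topo σ̄-ranking σ̄-beats-σ* X⊆σ̄ X⊆σpar (ℕP.≤-reflexive lcs≡|X|)
      output : ℕ→ℚ (totalUlam S σ̄) ℚ.+ ℕ→ℚ allActiveCost ℚ.≤
               N ℚ.* (ℕ→ℚ AR ℚ.+ ℕ→ℚ DA ℚ.+ ℕ→ℚ LD ℚ.+ ℕ→ℚ AR) ℚ.+ ℕ→ℚ OPT
      output = subst₂ ℚ._≤_ (ℕ→ℚ-+ (totalUlam S σ̄) allActiveCost)
        (trans (ℕ→ℚ-+ (n * (AR + DA + LD + AR)) OPT) (cong (ℚ._+ ℕ→ℚ OPT)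
          (trans (ℕ→ℚ-* n (AR + DA + LD + AR)) (cong (N ℚ.*_)
            (trans (ℕ→ℚ-+ (AR + DA + LD) AR) (cong (ℚ._+ ℕ→ℚ AR) (ℕ→ℚ-+₃ AR DA LD)))))))
        (ℕ→ℚ-mono-≤ (subst (λ A → totalUlam S σ̄ + allActiveCost ≤ n * (A + LD + AR) + OPT) #allActive≡ totalUlam-σ̄))
      deleted : N ℚ.* (ℕ→ℚ LD ℚ.+ ℕ→ℚ DA) ℚ.≤ κ ℚ.* N ℚ.* ℕ→ℚ DA ℚ.+ ℕ→ℚ activeCostDeleted
      deleted = subst (λ s → N ℚ.* s ℚ.≤ κ ℚ.* N ℚ.* ℕ→ℚ DA ℚ.+ ℕ→ℚ activeCostDeleted) (ℕ→ℚ-+ LD DA)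
        (ChargeableBy-cong (LD + DA) DA activeCostDeleted size-deleted≡ refl refl (deleted-chargeable {run} is-run (fromℕ d)))
      |A|*N≤β*OPT' : (ℕ→ℚ AR ℚ.+ ℕ→ℚ DA) ℚ.* N ℚ.≤ β ℚ.* ℕ→ℚ OPT
      |A|*N≤β*OPT' = subst (λ s → s ℚ.* N ℚ.≤ β ℚ.* ℕ→ℚ OPT)
        (trans (cong ℕ→ℚ (trans (length-filter≡Σ _ (allFin d)) #allActive≡)) (ℕ→ℚ-+ AR DA)) |A|*N≤β*OPT

totalUlam-no-rankings : ∀ {d n} (S : Fin n → List (Fin d)) σ → n ≡ 0 → totalUlam S σ ≡ 0
totalUlam-no-rankings S σ refl = refl

lemma3 :
    -- candidates [d], groups given by grp : Fin d → Fin g, fairness parameters λ, μ, k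
    (d g : ℕ) (grp : Fin d → Fin g) (lam mu : Fin g → ℚ) (k : ℕ) →
    (∀ i → 0ℚ ℚ.≤ lam i) → (∀ i → lam i ℚ.≤ 1ℚ) →
    (∀ i → 0ℚ ℚ.≤ mu i) → (∀ i → mu i ℚ.≤ 1ℚ) →
    1 ℕ.≤ k → k ℕ.≤ d →
    -- α ∈ [0, 1/10], β ∈ (0, 1)
    (α β : ℚ) → 0ℚ ℚ.≤ α → α ℚ.≤ + 1 / 10 → 0ℚ ℚ.< β → β ℚ.< 1ℚ →
    -- S : a set of n rankings
    (n : ℕ) (S : Fin n → List (Fin d)) → (∀ i → IsRanking (S i)) →
    Injective _≡_ _≡_ S →
    -- σ* : a fair median, OPT = Σ_π U(π, σ*)
    (σ* : List (Fin d)) → IsRanking σ* → Fair grp lam mu k σ* →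
    (∀ σ → IsRanking σ → Fair grp lam mu k σ → totalUlam S σ* ℕ.≤ totalUlam S σ) →
    -- fixed LCSs ℓ_π of π and σ*
    (ℓ : Fin n → List (Fin d)) → (∀ i → IsLCS (ℓ i) (S i) σ*) →
    -- hypothesis |A| ≤ β · OPT / n   (multiplied out by n)
    ℕ→ℚ (length (activeSet α ℓ)) ℚ.* ℕ→ℚ n ℚ.≤ β ℚ.* ℕ→ℚ (totalUlam S σ*) →
    -- any execution of the Relative Order Algorithm on (S, α):
    -- cycle-deletion run, topological ordering σpar of H̄, and output σ̄
    (run : Fin (suc d) → (Fin d → Bool)) → IsRun (Edge S α) run →
    (σpar : List (Fin d)) → IsTopOrder (Edge S α) (run (fromℕ d)) σpar →
    (σ̄ : List (Fin d)) → IsRanking σ̄ → Fair grp lam mu k σ̄ →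
    (∀ σ → IsRanking σ → Fair grp lam mu k σ → lcsLen σ σpar ℕ.≤ lcsLen σ̄ σpar) →
    -- conclusion
    ℕ→ℚ (totalUlam S σ̄) ℚ.≤
      (1ℚ ℚ.+ ℕ→ℚ 3 ℚ.* β ℚ.* (1ℚ ℚ.+ ℕ→ℚ 8 ℚ.* α)) ℚ.* ℕ→ℚ (totalUlam S σ*)
lemma3 d g grp lam mu k _ _ _ _ _ _ α β 0≤α α≤1/10 0<β _ n S S-ranking _ σ* σ*-ranking σ*-fair _
       ℓ ℓ-LCS |A|*n≤β*OPT run is-run σpar topo σ̄ σ̄-ranking _ σ̄-optimal =
  -- without rankings the threshold of H is 0, so the analysis needs n ≥ 1; both totals vanish then
  [ no-rankings
  , (λ n≢0 → Analysis.relative-order-bound S S-ranking σ* σ*-ranking ℓ ℓ-LCS α 0≤α α≤1/10 (ℕP.n≢0⇒n>0 n≢0)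
               {run} is-run topo σ̄-ranking (σ̄-optimal σ* σ*-ranking σ*-fair) β (ℚP.<⇒≤ 0<β) |A|*n≤β*OPT)
  ]′ (toSum (n ℕ.≟ 0))
  where
  c : ℚ
  c = 1ℚ ℚ.+ ℕ→ℚ 3 ℚ.* β ℚ.* (1ℚ ℚ.+ ℕ→ℚ 8 ℚ.* α)
  no-rankings : n ≡ 0 → ℕ→ℚ (totalUlam S σ̄) ℚ.≤ c ℚ.* ℕ→ℚ (totalUlam S σ*)
  no-rankings n≡0 = subst₂ (λ a b → ℕ→ℚ a ℚ.≤ c ℚ.* ℕ→ℚ b)
    (sym (totalUlam-no-rankings S σ̄ n≡0)) (sym (totalUlam-no-rankings S σ* n≡0))
    (ℚP.≤-reflexive (sym (ℚP.*-zeroʳ c)))
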